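{- Assume $S_1$ and $S_2$ are two simplices of $\mathcal{P}$ (not necessarily maximal). Let $\overrightarrow{F_k}$ be the fourientation $\chi(S_k)$ for $k=1,2$, and denote $\overrightarrow{F}=\overrightarrow{F_1}\cap(-\overrightarrow{F_2})$. Then $S_1^\circ\cap S_2^\circ\neq\emptyset$ if and only if $E(\overrightarrow{F_1})=E(\overrightarrow{F_2})$ and any one-way oriented edge in $\overrightarrow{F}$ belongs to a potential circuit of $\overrightarrow{F}$.
   Context: Let $\mathcal{M}$ be a loopless regular matroid with ground set $E=\{e_1,\dots,e_n\}$ represented by an $r\times n$ totally unimodular matrix $M$ of rank $r>0$. Signed circuits are the $\{0,\pm1\}$-vectors in $\ker_\mathbb{R}(M)$ with support a circuit; signed cocircuits are those in $\operatorname{im}_\mathbb{R}(M^T)$ with support a cocircuit; both are viewed as sets of arcs, where the arcs are $\overrightarrow{e_1},\dots,\overrightarrow{e_n}$ (standard unit vectors of $\mathbb{R}^E$) and $\overrightarrow{e_{ -i}}=-\overrightarrow{e_i}$. A fourientation is a set of arcs; an edge is bioriented, one-way oriented, or unoriented in it according as it contains two, one, or zero of its arcs; a potential circuit of $\overrightarrow{F}$ is a signed circuit contained in $\overrightarrow{F}$. For a fourientation $\overrightarrow{F}$, $E(\overrightarrow{F})=\{e\in E:\overrightarrow{F}\text{ contains an arc of }e\}$. The Lawrence polytope $\mathcal{P}$ is the convex hull of the columns $P_1,\dots,P_n,P_{ -1},\dots,P_{ -n}$ of $\begin{pmatrix} M & \mathbf{0} \\ I_{n\times n} & I_{n\times n}\end{pmatrix}$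 ($I_{n\times n}$ the $n\times n$ identity); these are its vertices. A simplex of $\mathcal{P}$ is a simplex whose vertices are vertices of $\mathcal{P}$; $S^\circ$ denotes relative interior. For a simplex $S$ of $\mathcal{P}$ with vertices $\{P_i:i\in I\}$, $\chi(S)$ is the fourientation $\{\overrightarrow{e_i}:i\in I\}$.
   Formalization: Points of $\mathcal{P}$, the barycentric coefficients of relative interiors, and all linear algebra (kernel, linear dependence, affine independence, rank) are taken over ℚ rather than ℝ. -}

module Defs where

open import Data.Nat using (ℕ; zero; suc)
open import Data.Integer as ℤ using (ℤ; +_; -_)
open import Data.Rational as ℚ using (ℚ; 0ℚ; 1ℚ)
open import Data.Fin using (Fin; zero; suc; toℕ; punchIn; _≟_)
open import Data.Bool using (Bool; true; false; not; if_then_else_)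
open import Data.Product using (Σ; _×_; _,_; ∃; ∃-syntax)
open import Data.Sum using (_⊎_; inj₁; inj₂)
open import Relation.Binary.PropositionalEquality using (_≡_; _≢_)
open import Relation.Nullary using (¬_; yes; no)
open import Function.Definitions using (Injective)

∑ℤ : ∀ k → (Fin k → ℤ) → ℤ
∑ℤ zero f = + 0
∑ℤ (suc k) f = f zero ℤ.+ ∑ℤ k (λ i → f (suc i))

∑ℚ : ∀ k → (Fin k → ℚ) → ℚ
∑ℚ zero f = 0ℚ
∑ℚ (suc k) f = f zero ℚ.+ ∑ℚ k (λ i → f (suc i))

toℚ : ℤ → ℚ
toℚ z = z ℚ./ 1

altSign : ∀ {k} → Fin k → ℤ
altSign zero = + 1
altSign (suc j) = - altSign j

det : ∀ k → (Fin k → Fin k → ℤ) → ℤ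
det zero A = + 1
det (suc k) A =
  ∑ℤ (suc k) (λ j → altSign j
                      ℤ.* (A zero j ℤ.* det k (λ a b → A (suc a) (punchIn j b))))

Matrix : ℕ → ℕ → Set
Matrix r n = Fin r → Fin n → ℤ

TotallyUnimodular : ∀ {r n} → Matrix r n → Set
TotallyUnimodular {r} {n} M =
  ∀ k (ρ : Fin k → Fin r) (κ : Fin k → Fin n) →
  Injective _≡_ _≡_ ρ → Injective _≡_ _≡_ κ →
  let d = det k (λ a b → M (ρ a) (κ b)) in
  (d ≡ + 0) ⊎ (d ≡ + 1) ⊎ (d ≡ - + 1)

-- rank r (over ℚ; the matrix is rational, so same as over ℝ): rows linearly independent
HasFullRowRank : ∀ {r n} → Matrix r n → Set
HasFullRowRank {r} {n} M =
  ∀ (y : Fin r → ℚ) → (∀ j → ∑ℚ r (λ i → y i ℚ.* toℚ (M i j)) ≡ 0ℚ) → ∀ i → y i ≡ 0ℚ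

InKerℚ : ∀ {r n} → Matrix r n → (Fin n → ℚ) → Set
InKerℚ {r} {n} M w = ∀ i → ∑ℚ n (λ j → toℚ (M i j) ℚ.* w j) ≡ 0ℚ

-- loopless: no column is zero (a loop is an element e with {e} dependent)
Loopless : ∀ {r n} → Matrix r n → Set
Loopless {r} {n} M = ∀ (e : Fin n) → ∃[ i ] (M i e ≢ + 0)

Subset : ℕ → Set₁
Subset n = Fin n → Set

Dependent : ∀ {r n} → Matrix r n → Subset n → Set
Dependent {r} {n} M X =
  Σ (Fin n → ℚ) λ w → InKerℚ M w × (∃[ e ] (w e ≢ 0ℚ)) × (∀ e → w e ≢ 0ℚ → X e)

IsCircuit : ∀ {r n} → Matrix r n → Subset n → Set₁
IsCircuit {r} {n} M C =
  Dependent M C × (∀ (X : Subset n) → (∀ e → X e → C e) → Dependent M X → ∀ e → C e → X e)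

Is01 : ℤ → Set
Is01 z = (z ≡ + 0) ⊎ (z ≡ + 1) ⊎ (z ≡ - + 1)

supp : ∀ {n} → (Fin n → ℤ) → Subset n
supp v e = v e ≢ + 0

IsSignedCircuit : ∀ {r n} → Matrix r n → (Fin n → ℤ) → Set₁
IsSignedCircuit {r} {n} M v =
  (∀ e → Is01 (v e)) × (∀ i → ∑ℤ n (λ j → M i j ℤ.* v j) ≡ + 0) × IsCircuit M (supp v)

-- arcs: (i , true) is the arc e_i, (i , false) is the arc e_{-i} = - e_i
Arc : ℕ → Set
Arc n = Fin n × Bool

negArc : ∀ {n} → Arc n → Arc n
negArc (i , b) = (i , not b)

Fourientation : ℕ → Set₁
Fourientation n = Arc n → Set

arcsOf : ∀ {n} → (Fin n → ℤ) → Fourientation n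
arcsOf v (i , true) = v i ≡ + 1
arcsOf v (i , false) = v i ≡ - + 1

EdgesOf : ∀ {n} → Fourientation n → Subset n
EdgesOf F e = F (e , true) ⊎ F (e , false)

OneWay : ∀ {n} → Fourientation n → Fin n → Set
OneWay F e = (F (e , true) × ¬ F (e , false)) ⊎ (F (e , false) × ¬ F (e , true))

InPotentialCircuit : ∀ {r n} → Matrix r n → Fourientation n → Fin n → Set₁
InPotentialCircuit {r} {n} M F e =
  Σ (Fin n → ℤ) λ v → IsSignedCircuit M v × (∀ a → arcsOf v a → F a) × (v e ≢ + 0)

∑Arc : ∀ n → (Arc n → ℚ) → ℚ
∑Arc n f = ∑ℚ n (λ i → f (i , true)) ℚ.+ ∑ℚ n (λ i → f (i , false))

-- the vertices P_a of the Lawrence polytope, coordinates indexed by Fin r ⊎ Fin n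
Point : ℕ → ℕ → Set
Point r n = Fin r ⊎ Fin n → ℚ

lawrenceVertex : ∀ {r n} → Matrix r n → Arc n → Point r n
lawrenceVertex M (i , true) (inj₁ k) = toℚ (M k i)
lawrenceVertex M (i , false) (inj₁ k) = 0ℚ
lawrenceVertex M (i , b) (inj₂ j) with i ≟ j
... | yes _ = 1ℚ
... | no _ = 0ℚ

combo : ∀ {r n} → Matrix r n → (Arc n → ℚ) → Point r n
combo {r} {n} M c x = ∑Arc n (λ a → c a ℚ.* lawrenceVertex M a x)

-- a simplex of P, given by its (finite, decidable) vertex set I ⊆ arcs:
-- nonempty and affinely independent vertices
IsSimplex : ∀ {r n} → Matrix r n → (Arc n → Bool) → Set
IsSimplex {r} {n} M I =
  (∃[ a ] (I a ≡ true)) ×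
  (∀ (c : Arc n → ℚ) → (∀ a → I a ≡ false → c a ≡ 0ℚ) →
     ∑Arc n c ≡ 0ℚ → (∀ x → combo M c x ≡ 0ℚ) → ∀ a → c a ≡ 0ℚ)

χ : ∀ {n} → (Arc n → Bool) → Fourientation n
χ I a = I a ≡ true

InRelInt : ∀ {r n} → Matrix r n → (Arc n → Bool) → Point r n → Set
InRelInt {r} {n} M I x =
  Σ (Arc n → ℚ) λ λ' →
    (∀ a → I a ≡ true → 0ℚ ℚ.< λ' a) × (∀ a → I a ≡ false → λ' a ≡ 0ℚ) ×
    (∑Arc n λ' ≡ 1ℚ) × (∀ y → combo M λ' y ≡ x y)

_∩neg_ : ∀ {n} → Fourientation n → Fourientation n → Fourientation n
(F₁ ∩neg F₂) a = F₁ a × F₂ (negArc a)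

-- Write points of the Lawrence polytope by coefficients c on the arcs: the lower coordinates
-- of Σ c_a P_a are the edge weights c(e⁺) + c(e⁻), the upper ones are M c⁺.  Two relative
-- interior representations c₁, c₂ of one point therefore have the same edges, and
-- w = c₁⁺ − c₂⁺ is a kernel vector of M conformal to F = F₁ ∩ −F₂ that is nonzero on every
-- one-way edge.  Conformal elimination reduces w to a minimal support, where the cofactors of a
-- nonsingular minor (entries 0, ±1 by total unimodularity) give a potential circuit through
-- that edge.  Conversely, the sum W of potential circuits through the one-way edges is a
-- kernel vector with the sign pattern of F; adding W⁺ to the arcs e⁺ of S₁ and e⁻ of S₂, and
-- W⁻ to the other arcs, on top of the arcs common to S₁ and S₂, gives two representations
-- of the same point with the prescribed supports.
{-# OPTIONS --safe #-}
module Submission where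

open import Defs
open import Algebra.Bundles using (CommutativeRing; AbelianGroup)
open import Data.Fin using (Fin; zero; suc; punchIn; punchOut; _≟_)
open import Data.Nat as ℕ using (ℕ; zero; suc)
open import Function using (_∘_)
open import Data.Bool using (Bool; true; false; if_then_else_)
import Data.Bool.Properties
open import Data.Empty using (⊥-elim)
open import Relation.Nullary using (¬_; Dec; yes; no; does)
open import Relation.Binary.PropositionalEquality.Core as ≡ using (_≡_; _≢_)
open import Function.Definitions using (Injective)
open import Relation.Binary.Definitions using (tri<; tri≈; tri>)
open import Data.Fin.Properties using (any?; all?; ¬∀⟶∃¬; punchIn-punchOut; punchIn-injective; punchInᵢ≢i)
open import Data.Product using (Σ; ∃-syntax; _×_; _,_; proj₁; proj₂)
open import Data.Sum using (_⊎_; inj₁; inj₂)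
open import Data.Vec.Functional using (_∷_)
open import Function.Bundles using (_⇔_; mk⇔; Equivalence)
open import Relation.Nullary.Decidable using (_×-dec_; _⊎-dec_; ¬?)
open import Data.Integer as ℤ using (ℤ; +_)
import Data.Integer.Properties as ℤP
import Data.Rational.Properties as ℚP

module Summation {c ℓ} (R : CommutativeRing c ℓ) where

  open CommutativeRing R hiding (zero)

  -- Any ∑ obeying the defining equations of ∑ℤ and ∑ℚ inherits the library's lemmas on sum.
  module Properties (∑ : ∀ k → (Fin k → Carrier) → Carrier)
    (∑-[] : ∀ f → ∑ 0 f ≈ 0#) (∑-∷ : ∀ k f → ∑ (suc k) f ≈ f zero + ∑ k (f ∘ suc)) where

    open import Algebra.Properties.Semiring.Sum semiring as Sum using (sum)
    open import Relation.Binary.Reasoning.Setoid setoid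

    ∑≈sum : ∀ k f → ∑ k f ≈ sum f
    ∑≈sum zero f = ∑-[] f
    ∑≈sum (suc k) f = trans (∑-∷ k f) (+-congˡ (∑≈sum k (f ∘ suc)))

    ∑-cong : ∀ k {f g : Fin k → Carrier} → (∀ i → f i ≈ g i) → ∑ k f ≈ ∑ k g
    ∑-cong k {f} {g} f≈g = begin
      ∑ k f   ≈⟨ ∑≈sum k f ⟩
      sum f   ≈⟨ Sum.sum-cong-≋ f≈g ⟩
      sum g   ≈⟨ ∑≈sum k g ⟨
      ∑ k g   ∎

    ∑-zero : ∀ k {f : Fin k → Carrier} → (∀ i → f i ≈ 0#) → ∑ k f ≈ 0#
    ∑-zero k {f} f≈0 = begin
      ∑ k f               ≈⟨ ∑≈sum k f ⟩
      sum f               ≈⟨ Sum.sum-cong-≋ f≈0 ⟩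
      sum {k} (λ _ → 0#)  ≈⟨ Sum.sum-replicate-zero k ⟩
      0#                  ∎

    ∑-distrib-+ : ∀ k (f g : Fin k → Carrier) → ∑ k (λ i → f i + g i) ≈ ∑ k f + ∑ k g
    ∑-distrib-+ k f g = begin
      ∑ k (λ i → f i + g i)   ≈⟨ ∑≈sum k _ ⟩
      sum (λ i → f i + g i)   ≈⟨ Sum.∑-distrib-+ f g ⟩
      sum f + sum g           ≈⟨ +-cong (∑≈sum k f) (∑≈sum k g) ⟨
      ∑ k f + ∑ k g           ∎

    ∑-comm : ∀ k m (f : Fin k → Fin m → Carrier) →
             ∑ k (λ i → ∑ m (f i)) ≈ ∑ m (λ j → ∑ k (λ i → f i j))
    ∑-comm k m f = begin
      ∑ k (λ i → ∑ m (f i))                 ≈⟨ ∑-cong k (λ i → ∑≈sum m (f i)) ⟩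
      ∑ k (λ i → sum (f i))                 ≈⟨ ∑≈sum k _ ⟩
      sum (λ i → sum (f i))                 ≈⟨ Sum.∑-comm f ⟩
      sum (λ j → sum (λ i → f i j))         ≈⟨ ∑≈sum m _ ⟨
      ∑ m (λ j → sum (λ i → f i j))         ≈⟨ ∑-cong m (λ j → ∑≈sum k (λ i → f i j)) ⟨
      ∑ m (λ j → ∑ k (λ i → f i j))         ∎

    ∑-remove : ∀ k (f : Fin (suc k) → Carrier) j → ∑ (suc k) f ≈ f j + ∑ k (f ∘ punchIn j)
    ∑-remove k f j = begin
      ∑ (suc k) f                ≈⟨ ∑≈sum (suc k) f ⟩
      sum f                      ≈⟨ Sum.sum-remove f ⟩
      f j + sum (f ∘ punchIn j)  ≈⟨ +-congˡ (∑≈sum k _) ⟨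
      f j + ∑ k (f ∘ punchIn j)  ∎

    *-distribˡ-∑ : ∀ k x (f : Fin k → Carrier) → x * ∑ k f ≈ ∑ k (λ i → x * f i)
    *-distribˡ-∑ k x f = begin
      x * ∑ k f                ≈⟨ *-congˡ (∑≈sum k f) ⟩
      x * sum f                ≈⟨ Sum.*-distribˡ-sum x f ⟩
      sum (λ i → x * f i)      ≈⟨ ∑≈sum k _ ⟨
      ∑ k (λ i → x * f i)      ∎

    δ : ∀ {k} → Fin k → Fin k → Carrier
    δ i j = if does (i ≟ j) then 1# else 0#

    δ-≢ : ∀ {k} {i j : Fin k} → i ≢ j → δ i j ≈ 0#
    δ-≢ {i = i} {j} i≢j with i ≟ j
    ... | yes i≡j = ⊥-elim (i≢j i≡j)
    ... | no _ = refl

    δ-cong : ∀ {k m} {i j : Fin k} {i′ j′ : Fin m} → (i ≡ j → i′ ≡ j′) → (i′ ≡ j′ → i ≡ j) → δ i j ≈ δ i′ j′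
    δ-cong {i = i} {j} {i′} {j′} ⇒ ⇐ with i ≟ j | i′ ≟ j′
    ... | yes _ | yes _ = refl
    ... | no _ | no _ = refl
    ... | yes i≡j | no i′≢j′ = ⊥-elim (i′≢j′ (⇒ i≡j))
    ... | no i≢j | yes i′≡j′ = ⊥-elim (i≢j (⇐ i′≡j′))

    ∑-δ : ∀ k i (f : Fin k → Carrier) → ∑ k (λ j → δ i j * f j) ≈ f i
    ∑-δ (suc k) zero f = begin
      ∑ (suc k) (λ j → δ zero j * f j)                      ≈⟨ ∑-∷ k _ ⟩
      1# * f zero + ∑ k (λ j → 0# * f (suc j))              ≈⟨ +-cong (*-identityˡ (f zero)) (∑-zero k (λ j → zeroˡ (f (suc j)))) ⟩
      f zero + 0#                                           ≈⟨ +-identityʳ (f zero) ⟩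
      f zero                                                ∎
    ∑-δ (suc k) (suc i) f = begin
      ∑ (suc k) (λ j → δ (suc i) j * f j)                   ≈⟨ ∑-∷ k _ ⟩
      0# * f zero + ∑ k (λ j → δ i j * f (suc j))           ≈⟨ +-cong (zeroˡ (f zero)) (∑-δ k i (f ∘ suc)) ⟩
      0# + f (suc i)                                        ≈⟨ +-identityˡ (f (suc i)) ⟩
      f (suc i)                                             ∎

    push : ∀ {s k} → (Fin s → Fin k) → (Fin s → Carrier) → Fin k → Carrier
    push {s} κ f l = ∑ s (λ t → δ (κ t) l * f t)

    VanishesOutside : ∀ {s k} → (Fin s → Fin k) → (Fin k → Carrier) → Set ℓ
    VanishesOutside κ u = ∀ l → (∀ t → κ t ≢ l) → u l ≈ 0#

    push-dot : ∀ {s} k (κ : Fin s → Fin k) (f : Fin s → Carrier) (g : Fin k → Carrier) → ∑ k (λ l → g l * push κ f l) ≈ ∑ s (λ t → g (κ t) * f t)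
    push-dot {s} k κ f g = begin
      ∑ k (λ l → g l * ∑ s (λ t → δ (κ t) l * f t))   ≈⟨ ∑-cong k (λ l → *-distribˡ-∑ s (g l) (λ t → δ (κ t) l * f t)) ⟩
      ∑ k (λ l → ∑ s (λ t → g l * (δ (κ t) l * f t))) ≈⟨ ∑-comm k s (λ l t → g l * (δ (κ t) l * f t)) ⟩
      ∑ s (λ t → ∑ k (λ l → g l * (δ (κ t) l * f t))) ≈⟨ ∑-cong s (λ t → ∑-cong k (λ l → x∙yz≈y∙xz (g l) (δ (κ t) l) (f t))) ⟩
      ∑ s (λ t → ∑ k (λ l → δ (κ t) l * (g l * f t))) ≈⟨ ∑-cong s (λ t → ∑-δ k (κ t) (λ l → g l * f t)) ⟩
      ∑ s (λ t → g (κ t) * f t)                       ∎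
      where open import Algebra.Properties.CommutativeSemigroup *-commutativeSemigroup using (x∙yz≈y∙xz)

    push-vanishesOutside : ∀ {s k} (κ : Fin s → Fin k) (f : Fin s → Carrier) → VanishesOutside κ (push κ f)
    push-vanishesOutside {s} κ f l l∉κ = ∑-zero s λ t → trans (*-congʳ (δ-≢ (l∉κ t))) (zeroˡ (f t))

    push-at : ∀ {s k} (κ : Fin s → Fin k) → Injective _≡_ _≡_ κ → ∀ (f : Fin s → Carrier) t → push κ f (κ t) ≈ f t
    push-at {s} κ κ-injective f t = begin
      ∑ s (λ t′ → δ (κ t′) (κ t) * f t′)   ≈⟨ ∑-cong s (λ t′ → *-congʳ (δ-cong (λ eq → ≡.sym (κ-injective eq)) (λ eq → ≡.cong κ (≡.sym eq)))) ⟩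
      ∑ s (λ t′ → δ t t′ * f t′)            ≈⟨ ∑-δ s t f ⟩
      f t                                   ∎

    push-restrict : ∀ {s k} (κ : Fin s → Fin k) → Injective _≡_ _≡_ κ → ∀ (u : Fin k → Carrier) → VanishesOutside κ u →
                    ∀ l → push κ (u ∘ κ) l ≈ u l
    push-restrict κ κ-injective u u≈0 l with any? (λ t → κ t ≟ l)
    ... | yes (t , ≡.refl) = push-at κ κ-injective (u ∘ κ) t
    ... | no l∉κ = trans (push-vanishesOutside κ (u ∘ κ) l (λ t κt≡l → l∉κ (t , κt≡l))) (sym (u≈0 l (λ t κt≡l → l∉κ (t , κt≡l))))

    ∑-restrict : ∀ {s} k (κ : Fin s → Fin k) → Injective _≡_ _≡_ κ → ∀ (u g : Fin k → Carrier) → VanishesOutside κ u →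
                 ∑ k (λ l → g l * u l) ≈ ∑ s (λ t → g (κ t) * u (κ t))
    ∑-restrict k κ κ-injective u g u≈0 =
      trans (∑-cong k (λ l → *-congˡ (sym (push-restrict κ κ-injective u u≈0 l)))) (push-dot k κ (u ∘ κ) g)

open import Relation.Binary.PropositionalEquality

module ℤΣ = Summation.Properties ℤP.+-*-commutativeRing ∑ℤ (λ _ → refl) (λ _ _ → refl)
module ℚΣ = Summation.Properties ℚP.+-*-commutativeRing ∑ℚ (λ _ → refl) (λ _ _ → refl)

module Determinant where

  open import Data.Integer using (_+_; _*_; -_)
  open import Data.Integer.Solver using (module +-*-Solver)
  open +-*-Solver
  open import Algebra.Properties.Group (AbelianGroup.group ℤP.+-0-abelianGroup) using (∙-cancelˡ)
  open ℤΣ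
  open ≡-Reasoning

  det-cong : ∀ k {A B : Fin k → Fin k → ℤ} → (∀ a b → A a b ≡ B a b) → det k A ≡ det k B
  det-cong zero A≡B = refl
  det-cong (suc k) A≡B = ∑-cong (suc k) λ j →
    cong₂ (λ x y → altSign j * (x * y)) (A≡B zero j) (det-cong k (λ a b → A≡B (suc a) (punchIn j b)))

  -- A total version of punchOut; its value at j′ = j is junk.
  punchOut′ : ∀ {n} → Fin (suc (suc n)) → Fin (suc (suc n)) → Fin (suc n)
  punchOut′ zero zero = zero
  punchOut′ zero (suc j′) = j′
  punchOut′ (suc j) zero = zero
  punchOut′ {suc n} (suc j) (suc j′) = suc (punchOut′ j j′)
  punchOut′ {zero} (suc j) (suc j′) = zero

  punchOut′-punchIn : ∀ {n} (j : Fin (suc (suc n))) l → punchOut′ j (punchIn j l) ≡ l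
  punchOut′-punchIn zero l = refl
  punchOut′-punchIn (suc j) zero = refl
  punchOut′-punchIn {suc n} (suc j) (suc l) = cong suc (punchOut′-punchIn j l)
  punchOut′-punchIn {zero} (suc zero) (suc ())

  -- Deleting columns j and then l is deleting j′ = punchIn j l and then j (renumbered):
  -- the two orders of a double Laplace expansion along the first two rows.
  punchIn-punchIn : ∀ {n} (j : Fin (suc (suc n))) l b →
    punchIn j (punchIn l b) ≡ punchIn (punchIn j l) (punchIn (punchOut′ (punchIn j l) j) b)
  punchIn-punchIn zero l b = refl
  punchIn-punchIn (suc j) zero b = refl
  punchIn-punchIn {suc n} (suc j) (suc l) zero = refl
  punchIn-punchIn {suc n} (suc j) (suc l) (suc b) = cong suc (punchIn-punchIn j l b)

  altSign-punchIn : ∀ {n} (j : Fin (suc (suc n))) l →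
    altSign j * altSign l ≡ - (altSign (punchIn j l) * altSign (punchOut′ (punchIn j l) j))
  altSign-punchIn zero l = solve 1 (λ a → con (+ 1) :* a := :- ((:- a) :* con (+ 1))) refl (altSign l)
  altSign-punchIn (suc j) zero = solve 1 (λ a → (:- a) :* con (+ 1) := :- (con (+ 1) :* a)) refl (altSign j)
  altSign-punchIn {suc n} (suc j) (suc l) = begin
    (- altSign j) * (- altSign l)  ≡⟨ solve 2 (λ a b → (:- a) :* (:- b) := a :* b) refl (altSign j) (altSign l) ⟩
    altSign j * altSign l          ≡⟨ altSign-punchIn j l ⟩
    - (s * t)                      ≡⟨ cong -_ (solve 2 (λ a b → a :* b := (:- a) :* (:- b)) refl s t) ⟩
    - ((- s) * (- t))              ∎
    where s = altSign (punchIn j l); t = altSign (punchOut′ (punchIn j l) j)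
  altSign-punchIn {zero} (suc zero) (suc ())

  swap₀₁ : ∀ {k m} → (Fin (suc (suc k)) → Fin m → ℤ) → Fin (suc (suc k)) → Fin m → ℤ
  swap₀₁ A zero = A (suc zero)
  swap₀₁ A (suc zero) = A zero
  swap₀₁ A (suc (suc a)) = A (suc (suc a))

  module DoubleExpansion {k : ℕ} where

    N : ℕ
    N = suc (suc k)

    -- term B j j′ of the expansion of det B along rows 0 and 1 (columns j, then j′);
    -- the diagonal j′ = j does not occur in det B.
    term : (Fin N → Fin N → ℤ) → Fin N → Fin N → ℤ
    term B j j′ = (altSign j * altSign (punchOut′ j j′)) *
      ((B zero j * B (suc zero) j′) * det k (λ a b → B (suc (suc a)) (punchIn j (punchIn (punchOut′ j j′) b))))

    off-diagonal : ∀ B j → altSign j * (B zero j * det (suc k) (λ a b → B (suc a) (punchIn j b)))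
                           ≡ ∑ℤ (suc k) (λ l → term B j (punchIn j l))
    off-diagonal B j = begin
      altSign j * (B zero j * ∑ℤ (suc k) T)        ≡⟨ cong (altSign j *_) (*-distribˡ-∑ (suc k) (B zero j) T) ⟩
      altSign j * ∑ℤ (suc k) (λ l → B zero j * T l) ≡⟨ *-distribˡ-∑ (suc k) (altSign j) (λ l → B zero j * T l) ⟩
      ∑ℤ (suc k) (λ l → altSign j * (B zero j * T l)) ≡⟨ ∑-cong (suc k) reassoc ⟩
      ∑ℤ (suc k) (λ l → term B j (punchIn j l))      ∎
      where
      T : Fin (suc k) → ℤ
      T l = altSign l * (B (suc zero) (punchIn j l) * det k (λ a b → B (suc (suc a)) (punchIn j (punchIn l b))))
      reassoc : ∀ l → altSign j * (B zero j * T l) ≡ term B j (punchIn j l)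
      reassoc l rewrite punchOut′-punchIn j l =
        solve 5 (λ s a t y d → s :* (a :* (t :* (y :* d))) := (s :* t) :* ((a :* y) :* d)) refl
          (altSign j) (B zero j) (altSign l) (B (suc zero) (punchIn j l))
          (det k (λ a b → B (suc (suc a)) (punchIn j (punchIn l b))))

    expansion : ∀ B → ∑ℤ N (λ j → ∑ℤ N (term B j)) ≡ ∑ℤ N (λ j → term B j j) + det N B
    expansion B = begin
      ∑ℤ N (λ j → ∑ℤ N (term B j))
        ≡⟨ ∑-cong N (λ j → ∑-remove (suc k) (term B j) j) ⟩
      ∑ℤ N (λ j → term B j j + ∑ℤ (suc k) (λ l → term B j (punchIn j l)))
        ≡⟨ ∑-distrib-+ N (λ j → term B j j) (λ j → ∑ℤ (suc k) (λ l → term B j (punchIn j l))) ⟩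
      ∑ℤ N (λ j → term B j j) + ∑ℤ N (λ j → ∑ℤ (suc k) (λ l → term B j (punchIn j l)))
        ≡⟨ cong (_+_ (∑ℤ N (λ j → term B j j))) (∑-cong N (off-diagonal B)) ⟨
      ∑ℤ N (λ j → term B j j) + det N B ∎

    term-swap₀₁ : ∀ A j l → term A j (punchIn j l) + term (swap₀₁ A) (punchIn j l) j ≡ + 0
    term-swap₀₁ A j l
      rewrite punchOut′-punchIn j l | altSign-punchIn j l
            | det-cong k (λ a b → cong (A (suc (suc a))) (punchIn-punchIn j l b)) =
      solve 4 (λ σ x y D → (:- σ) :* ((x :* y) :* D) :+ σ :* ((y :* x) :* D) := con (+ 0)) refl
        (altSign (punchIn j l) * altSign (punchOut′ (punchIn j l) j)) (A zero j) (A (suc zero) (punchIn j l))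
        (det k (λ a b → A (suc (suc a)) (punchIn (punchIn j l) (punchIn (punchOut′ (punchIn j l) j) b))))

  -- The sum of the two double expansions of det A and det (swap₀₁ A) pairs each
  -- off-diagonal term with its transpose, and these cancel.
  det-swap₀₁ : ∀ {k} (A : Fin (suc (suc k)) → Fin (suc (suc k)) → ℤ) → det _ A + det _ (swap₀₁ A) ≡ + 0
  det-swap₀₁ {k} A = ∙-cancelˡ (a + b) _ _ (begin
    (a + b) + (det N A + det N A′)   ≡⟨ solve 4 (λ a b x y → (a :+ b) :+ (x :+ y) := (a :+ x) :+ (b :+ y)) refl a b (det N A) (det N A′) ⟩
    (a + det N A) + (b + det N A′)   ≡⟨ cong₂ _+_ (expansion A) (trans (∑-comm N N (λ j j′ → term A′ j′ j)) (expansion A′)) ⟨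
    ∑ℤ N (λ j → ∑ℤ N (term A j)) + ∑ℤ N (λ j → ∑ℤ N (λ j′ → term A′ j′ j))
                                     ≡⟨ ∑-distrib-+ N (λ j → ∑ℤ N (term A j)) (λ j → ∑ℤ N (λ j′ → term A′ j′ j)) ⟨
    ∑ℤ N (λ j → ∑ℤ N (term A j) + ∑ℤ N (λ j′ → term A′ j′ j)) ≡⟨ ∑-cong N (λ j → ∑-distrib-+ N (term A j) (λ j′ → term A′ j′ j)) ⟨
    ∑ℤ N (λ j → ∑ℤ N (G j))          ≡⟨ ∑-cong N diagonal ⟩
    ∑ℤ N (λ j → term A j j + term A′ j j) ≡⟨ ∑-distrib-+ N (λ j → term A j j) (λ j → term A′ j j) ⟩
    a + b                            ≡⟨ ℤP.+-identityʳ (a + b) ⟨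
    (a + b) + + 0                    ∎)
    where
    open DoubleExpansion {k}
    A′ = swap₀₁ A
    a = ∑ℤ N (λ j → term A j j)
    b = ∑ℤ N (λ j → term A′ j j)
    G : Fin N → Fin N → ℤ
    G j j′ = term A j j′ + term A′ j′ j
    diagonal : ∀ j → ∑ℤ N (G j) ≡ G j j
    diagonal j = begin
      ∑ℤ N (G j)                                   ≡⟨ ∑-remove (suc k) (G j) j ⟩
      G j j + ∑ℤ (suc k) (λ l → G j (punchIn j l))  ≡⟨ cong (_+_ (G j j)) (∑-zero (suc k) (term-swap₀₁ A j)) ⟩
      G j j + + 0                                  ≡⟨ ℤP.+-identityʳ (G j j) ⟩
      G j j                                        ∎

  det-equalRows : ∀ k (A : Fin (suc k) → Fin (suc k) → ℤ) i → (∀ b → A zero b ≡ A (suc i) b) → det (suc k) A ≡ + 0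
  det-equalRows (suc k) A zero A₀≡A₁ = self-inverse (begin
    det _ A + det _ A            ≡⟨ cong (_+_ (det _ A)) (det-cong (suc (suc k)) A≡swap) ⟩
    det _ A + det _ (swap₀₁ A)   ≡⟨ det-swap₀₁ A ⟩
    + 0                          ∎)
    where
    A≡swap : ∀ a b → A a b ≡ swap₀₁ A a b
    A≡swap zero b = A₀≡A₁ b
    A≡swap (suc zero) b = sym (A₀≡A₁ b)
    A≡swap (suc (suc a)) b = refl
    self-inverse : ∀ {d} → d + d ≡ + 0 → d ≡ + 0
    self-inverse {d} d+d≡0 with ℤP.i*j≡0⇒i≡0∨j≡0 (+ 2) (trans (solve 1 (λ d → con (+ 2) :* d := d :+ d) refl d) d+d≡0)
    ... | inj₁ ()
    ... | inj₂ d≡0 = d≡0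
  det-equalRows (suc k) A (suc i) A₀≡Aᵢ = begin
    det _ A                       ≡⟨ solve 2 (λ x y → x := :- y :+ (x :+ y)) refl (det _ A) (det _ (swap₀₁ A)) ⟩
    - det _ (swap₀₁ A) + (det _ A + det _ (swap₀₁ A)) ≡⟨ cong₂ (λ x y → - x + y) swap≡0 (det-swap₀₁ A) ⟩
    + 0                           ∎
    where
    -- in swap₀₁ A, the rows 1 and i + 2 are both A 0, and survive in every minor of row 0
    swap≡0 : det _ (swap₀₁ A) ≡ + 0
    swap≡0 = ∑-zero (suc (suc k)) λ j → begin
      altSign j * (swap₀₁ A zero j * det _ (λ a b → swap₀₁ A (suc a) (punchIn j b)))
        ≡⟨ cong (λ d → altSign j * (swap₀₁ A zero j * d)) (det-equalRows k (λ a b → swap₀₁ A (suc a) (punchIn j b)) i (λ b → A₀≡Aᵢ (punchIn j b))) ⟩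
      altSign j * (swap₀₁ A zero j * + 0)
        ≡⟨ solve 2 (λ s x → s :* (x :* con (+ 0)) := con (+ 0)) refl (altSign j) (swap₀₁ A zero j) ⟩
      + 0 ∎

  cofactor : ∀ {k} → (Fin k → Fin (suc k) → ℤ) → Fin (suc k) → ℤ
  cofactor {k} B j = altSign j * det k (λ a b → B a (punchIn j b))

  det-∷ : ∀ k y (B : Fin k → Fin (suc k) → ℤ) → det (suc k) (y ∷ B) ≡ ∑ℤ (suc k) (λ j → y j * cofactor B j)
  det-∷ k y B = ∑-cong (suc k) λ j →
    solve 3 (λ a s d → s :* (a :* d) := a :* (s :* d)) refl (y j) (altSign j) (det k (λ a b → B a (punchIn j b)))

  cofactor-orthogonal : ∀ k (B : Fin k → Fin (suc k) → ℤ) i → ∑ℤ (suc k) (λ j → B i j * cofactor B j) ≡ + 0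
  cofactor-orthogonal k B i = trans (sym (det-∷ k (B i) B)) (det-equalRows k (B i ∷ B) i (λ _ → refl))

  cofactor-zero : ∀ {k} (B : Fin k → Fin (suc k) → ℤ) → cofactor B zero ≡ det k (λ a b → B a (suc b))
  cofactor-zero {k} B = ℤP.*-identityˡ (det k (λ a b → B a (suc b)))

open Determinant using (det-equalRows; cofactor; det-∷; cofactor-orthogonal; cofactor-zero)

open import Data.Rational as ℚ using (ℚ; 0ℚ; 1ℚ; mkℚ; _+_; _*_; _-_; -_)
open import Data.Rational.Unnormalised as ℚᵘ using (mkℚᵘ; *≡*)
import Data.Rational.Unnormalised.Properties as ℚᵘP
import Data.Nat.Coprimality as Coprimality
open import Data.Rational.Solver renaming (module +-*-Solver to ℚ-Solver)
open ℚ-Solver using (solve; _:+_; _:*_; :-_; _:-_; con; _:=_)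

module IntegerEmbedding where

  private
    toℚ≡mkℚ : ∀ z → toℚ z ≡ mkℚ z 0 (Coprimality.sym (Coprimality.1-coprimeTo ℤ.∣ z ∣))
    toℚ≡mkℚ z = ℚP.↥p/↧p≡p (mkℚ z 0 (Coprimality.sym (Coprimality.1-coprimeTo ℤ.∣ z ∣)))

    toℚᵘ-toℚ : ∀ z → ℚ.toℚᵘ (toℚ z) ≡ mkℚᵘ z 0
    toℚᵘ-toℚ z = cong ℚ.toℚᵘ (toℚ≡mkℚ z)

    -- a homomorphism law for toℚ follows from the same law for z ↦ z / 1 in ℚᵘ
    via-ℚᵘ : ∀ {x y : ℚ} {u v} → ℚ.toℚᵘ x ≡ u → ℚ.toℚᵘ y ≡ v → u ℚᵘ.≃ v → x ≡ y
    via-ℚᵘ refl refl u≃v = ℚP.toℚᵘ-injective u≃v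

  toℚ-injective : ∀ {a b} → toℚ a ≡ toℚ b → a ≡ b
  toℚ-injective {a} {b} eq = begin
    a               ≡⟨ cong ℚ.↥_ (toℚ≡mkℚ a) ⟨
    ℚ.↥ (toℚ a)     ≡⟨ cong ℚ.↥_ eq ⟩
    ℚ.↥ (toℚ b)     ≡⟨ cong ℚ.↥_ (toℚ≡mkℚ b) ⟩
    b               ∎
    where open ≡-Reasoning

  toℚ-homo-+ : ∀ a b → toℚ (a ℤ.+ b) ≡ toℚ a + toℚ b
  toℚ-homo-+ a b = via-ℚᵘ (toℚᵘ-toℚ (a ℤ.+ b)) refl (ℚᵘP.≃-trans
    (*≡* (trans (ℤP.*-identityʳ (a ℤ.+ b))
      (sym (trans (ℤP.*-identityʳ _) (cong₂ ℤ._+_ (ℤP.*-identityʳ a) (ℤP.*-identityʳ b))))))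
    (ℚᵘP.≃-sym (subst₂ (λ x y → ℚ.toℚᵘ (toℚ a + toℚ b) ℚᵘ.≃ (x ℚᵘ.+ y)) (toℚᵘ-toℚ a) (toℚᵘ-toℚ b) (ℚP.toℚᵘ-homo-+ (toℚ a) (toℚ b)))))

  toℚ-homo-* : ∀ a b → toℚ (a ℤ.* b) ≡ toℚ a * toℚ b
  toℚ-homo-* a b = via-ℚᵘ (toℚᵘ-toℚ (a ℤ.* b)) refl
    (ℚᵘP.≃-sym (subst₂ (λ x y → ℚ.toℚᵘ (toℚ a * toℚ b) ℚᵘ.≃ (x ℚᵘ.* y)) (toℚᵘ-toℚ a) (toℚᵘ-toℚ b) (ℚP.toℚᵘ-homo-* (toℚ a) (toℚ b))))

  toℚ-homo-∑ : ∀ k (f : Fin k → ℤ) → toℚ (∑ℤ k f) ≡ ∑ℚ k (toℚ ∘ f)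
  toℚ-homo-∑ zero f = refl
  toℚ-homo-∑ (suc k) f = trans (toℚ-homo-+ (f zero) _) (cong (_+_ (toℚ (f zero))) (toℚ-homo-∑ k (f ∘ suc)))

  toℚ-homo-dot : ∀ k (y c : Fin k → ℤ) → toℚ (∑ℤ k (λ j → y j ℤ.* c j)) ≡ ∑ℚ k (λ j → toℚ (y j) * toℚ (c j))
  toℚ-homo-dot k y c = trans (toℚ-homo-∑ k _) (ℚΣ.∑-cong k (λ j → toℚ-homo-* (y j) (c j)))

open IntegerEmbedding

module ZeroProducts where

  p*q≡0⇒p≡0 : ∀ p q → p * q ≡ 0ℚ → q ≢ 0ℚ → p ≡ 0ℚ
  p*q≡0⇒p≡0 p q pq≡0 q≢0 = begin
    p                   ≡⟨ ℚP.*-identityʳ p ⟨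
    p * 1ℚ              ≡⟨ cong (p *_) (ℚP.*-inverseʳ q) ⟨
    p * (q * q⁻¹)       ≡⟨ ℚP.*-assoc p q q⁻¹ ⟨
    (p * q) * q⁻¹       ≡⟨ cong (_* q⁻¹) pq≡0 ⟩
    0ℚ * q⁻¹            ≡⟨ ℚP.*-zeroˡ q⁻¹ ⟩
    0ℚ                  ∎
    where
    open ≡-Reasoning
    instance
      q-nonZero : ℚ.NonZero q
      q-nonZero = ℚ.≢-nonZero q≢0
    q⁻¹ = ℚ.1/ q

  p*q≡0⇒q≡0 : ∀ p q → p * q ≡ 0ℚ → p ≢ 0ℚ → q ≡ 0ℚ
  p*q≡0⇒q≡0 p q pq≡0 = p*q≡0⇒p≡0 q p (trans (ℚP.*-comm q p) pq≡0)

  *-≢0 : ∀ {p q} → p ≢ 0ℚ → q ≢ 0ℚ → p * q ≢ 0ℚ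
  *-≢0 {p} {q} p≢0 q≢0 pq≡0 = p≢0 (p*q≡0⇒p≡0 p q pq≡0 q≢0)

open ZeroProducts

module Kernels where

  open ℚΣ
  open ≡-Reasoning

  NonzeroKernel : ∀ {r m} → Matrix r m → Set
  NonzeroKernel {r} {m} A = Σ (Fin m → ℚ) λ z → InKerℚ A z × ∃[ t ] (z t ≢ 0ℚ)

  NonsingularRows : ∀ {r m} → Matrix r m → Set
  NonsingularRows {r} {m} A = Σ (Fin m → Fin r) λ ρ → Injective _≡_ _≡_ ρ × det m (λ a b → A (ρ a) b) ≢ + 0

  InKerℚ-lincomb : ∀ {r m} (A : Matrix r m) a b {x y : Fin m → ℚ} →
                   InKerℚ A x → InKerℚ A y → InKerℚ A (λ j → a * x j + b * y j)
  InKerℚ-lincomb {m = m} A a b {x} {y} Ax≡0 Ay≡0 i = begin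
    ∑ℚ m (λ j → Aᵢ j * (a * x j + b * y j))                 ≡⟨ ∑-cong m (λ j → solve 5 (λ q a x b y → q :* (a :* x :+ b :* y) := a :* (q :* x) :+ b :* (q :* y)) refl (Aᵢ j) a (x j) b (y j)) ⟩
    ∑ℚ m (λ j → a * (Aᵢ j * x j) + b * (Aᵢ j * y j))         ≡⟨ ∑-distrib-+ m (λ j → a * (Aᵢ j * x j)) (λ j → b * (Aᵢ j * y j)) ⟩
    ∑ℚ m (λ j → a * (Aᵢ j * x j)) + ∑ℚ m (λ j → b * (Aᵢ j * y j)) ≡⟨ cong₂ _+_ (*-distribˡ-∑ m a (λ j → Aᵢ j * x j)) (*-distribˡ-∑ m b (λ j → Aᵢ j * y j)) ⟨
    a * ∑ℚ m (λ j → Aᵢ j * x j) + b * ∑ℚ m (λ j → Aᵢ j * y j)  ≡⟨ cong₂ (λ p q → a * p + b * q) (Ax≡0 i) (Ay≡0 i) ⟩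
    a * 0ℚ + b * 0ℚ                                          ≡⟨ solve 2 (λ a b → a :* con 0ℚ :+ b :* con 0ℚ := con 0ℚ) refl a b ⟩
    0ℚ                                                       ∎
    where
    Aᵢ : Fin m → ℚ
    Aᵢ j = toℚ (A i j)

  InKerℚ-removeAt : ∀ {r m} (A : Matrix r (suc m)) {z : Fin (suc m) → ℚ} j → InKerℚ A z → z j ≡ 0ℚ →
                    InKerℚ (λ i b → A i (punchIn j b)) (z ∘ punchIn j)
  InKerℚ-removeAt {m = m} A {z} j Az≡0 zⱼ≡0 i = begin
    rest                       ≡⟨ ℚP.+-identityˡ rest ⟨
    0ℚ + rest                  ≡⟨ cong (_+ rest) (trans (cong (toℚ (A i j) *_) zⱼ≡0) (ℚP.*-zeroʳ (toℚ (A i j)))) ⟨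
    toℚ (A i j) * z j + rest   ≡⟨ ∑-remove m (λ l → toℚ (A i l) * z l) j ⟨
    ∑ℚ (suc m) (λ l → toℚ (A i l) * z l)                            ≡⟨ Az≡0 i ⟩
    0ℚ                                                             ∎
    where
    rest = ∑ℚ m (λ b → toℚ (A i (punchIn j b)) * z (punchIn j b))

  InKerℚ-cong : ∀ {r m} (A : Matrix r m) {x y : Fin m → ℚ} → (∀ j → x j ≡ y j) → InKerℚ A x → InKerℚ A y
  InKerℚ-cong {m = m} A x≡y Ax≡0 i = trans (∑-cong m (λ j → cong (toℚ (A i j) *_) (sym (x≡y j)))) (Ax≡0 i)

  cofactor-InKerℚ : ∀ {k} (B : Matrix k (suc k)) → InKerℚ B (toℚ ∘ cofactor B)
  cofactor-InKerℚ {k} B i = trans (sym (toℚ-homo-dot (suc k) (B i) (cofactor B)))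
                                  (cong toℚ (cofactor-orthogonal k B i))

  private
    module CofactorCombination {k} (B : Matrix k (suc k)) (x : Fin (suc k) → ℚ) where
      c : Fin (suc k) → ℚ
      c = toℚ ∘ cofactor B
      z : Fin (suc k) → Fin (suc k) → ℚ
      z j₀ l = x j₀ * c l + (- c j₀) * x l
      z-diagonal : ∀ j₀ → z j₀ j₀ ≡ 0ℚ
      z-diagonal j₀ = solve 2 (λ a b → a :* b :+ (:- b) :* a := con 0ℚ) refl (x j₀) (c j₀)

    -- z = x j₀ · c − c j₀ · x lies in ker B and vanishes at j₀; deleting column j₀, the
    -- induction hypothesis shows that z = 0, since the minor at j₀ is nonsingular.
    proportional-to-cofactor :
      ∀ k → (∀ (A : Matrix k k) → NonzeroKernel A → det k A ≡ + 0) →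
      (B : Matrix k (suc k)) (x : Fin (suc k) → ℚ) → InKerℚ B x → ∀ j₀ → cofactor B j₀ ≢ + 0 →
      ∀ l → x j₀ * toℚ (cofactor B l) ≡ toℚ (cofactor B j₀) * x l
    proportional-to-cofactor k IH B x Bx≡0 j₀ cⱼ₀≢0 l
      with all? (λ b → CofactorCombination.z B x j₀ (punchIn j₀ b) ℚP.≟ 0ℚ)
    ... | no z≢0 = ⊥-elim (cⱼ₀≢0 (begin
      altSign j₀ ℤ.* det k (λ a b → B a (punchIn j₀ b)) ≡⟨ cong (altSign j₀ ℤ.*_) (IH _ (z j₀ ∘ punchIn j₀ , Bz≡0 , ¬∀⟶∃¬ k _ (λ b → z j₀ (punchIn j₀ b) ℚP.≟ 0ℚ) z≢0)) ⟩
      altSign j₀ ℤ.* + 0                               ≡⟨ ℤP.*-zeroʳ (altSign j₀) ⟩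
      + 0                                              ∎))
      where
      open CofactorCombination B x
      Bz≡0 : InKerℚ (λ i b → B i (punchIn j₀ b)) (z j₀ ∘ punchIn j₀)
      Bz≡0 = InKerℚ-removeAt B {z j₀} j₀ (InKerℚ-lincomb B (x j₀) (- c j₀) {c} {x} (cofactor-InKerℚ B) Bx≡0) (z-diagonal j₀)
    ... | yes z∘punchIn≡0 = begin
      x j₀ * c l                    ≡⟨ solve 3 (λ a v b → a := (a :+ (:- v) :* b) :+ v :* b) refl (x j₀ * c l) (c j₀) (x l) ⟩
      z j₀ l + c j₀ * x l           ≡⟨ cong (_+ c j₀ * x l) z≡0 ⟩
      0ℚ + c j₀ * x l               ≡⟨ ℚP.+-identityˡ (c j₀ * x l) ⟩
      c j₀ * x l                    ∎
      where
      open CofactorCombination B x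
      z≡0 : z j₀ l ≡ 0ℚ
      z≡0 with l ≟ j₀
      ... | yes refl = z-diagonal j₀
      ... | no l≢j₀ = subst (λ l → z j₀ l ≡ 0ℚ) (punchIn-punchOut (l≢j₀ ∘ sym)) (z∘punchIn≡0 _)

  -- Expand det A along row 0: det A = A₀ · c for the cofactor vector c of A ∘ suc.
  -- Either c = 0, or x ∝ c and then det A ∝ A₀ · x = 0.
  nonzeroKernel⇒det≡0 : ∀ k (A : Matrix k k) → NonzeroKernel A → det k A ≡ + 0
  nonzeroKernel⇒det≡0 zero A (x , _ , () , _)
  nonzeroKernel⇒det≡0 (suc k) A (x , Ax≡0 , t , xₜ≢0) with all? (λ j → cofactor (A ∘ suc) j ℤP.≟ + 0)
  ... | yes c≡0 = trans (det-∷ k (A zero) (A ∘ suc))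
                        (ℤΣ.∑-zero (suc k) λ j → trans (cong (A zero j ℤ.*_) (c≡0 j)) (ℤP.*-zeroʳ (A zero j)))
  ... | no c≢0 with ¬∀⟶∃¬ (suc k) _ (λ j → cofactor (A ∘ suc) j ℤP.≟ + 0) c≢0
  ...   | j₀ , cⱼ₀≢0 = toℚ-injective (p*q≡0⇒p≡0 _ (x j₀) det·xⱼ₀≡0 xⱼ₀≢0)
    where
    open CofactorCombination (A ∘ suc) x
    x∝c : ∀ l → x j₀ * c l ≡ c j₀ * x l
    x∝c = proportional-to-cofactor k (nonzeroKernel⇒det≡0 k) (A ∘ suc) x (Ax≡0 ∘ suc) j₀ cⱼ₀≢0
    xⱼ₀≢0 : x j₀ ≢ 0ℚ
    xⱼ₀≢0 xⱼ₀≡0 = xₜ≢0 (p*q≡0⇒q≡0 (c j₀) (x t) (begin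
      c j₀ * x t   ≡⟨ x∝c t ⟨
      x j₀ * c t   ≡⟨ cong (_* c t) xⱼ₀≡0 ⟩
      0ℚ * c t     ≡⟨ ℚP.*-zeroˡ (c t) ⟩
      0ℚ              ∎) (cⱼ₀≢0 ∘ toℚ-injective))
    A₀ : Fin (suc k) → ℚ
    A₀ j = toℚ (A zero j)
    det·xⱼ₀≡0 : toℚ (det (suc k) A) * x j₀ ≡ 0ℚ
    det·xⱼ₀≡0 = begin
      toℚ (det (suc k) A) * x j₀                    ≡⟨ cong (λ d → toℚ d * x j₀) (det-∷ k (A zero) (A ∘ suc)) ⟩
      toℚ (∑ℤ (suc k) (λ j → A zero j ℤ.* cofactor (A ∘ suc) j)) * x j₀ ≡⟨ cong (_* x j₀) (toℚ-homo-dot (suc k) (A zero) (cofactor (A ∘ suc))) ⟩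
      ∑ℚ (suc k) (λ j → A₀ j * c j) * x j₀      ≡⟨ ℚP.*-comm _ (x j₀) ⟩
      x j₀ * ∑ℚ (suc k) (λ j → A₀ j * c j)      ≡⟨ *-distribˡ-∑ (suc k) (x j₀) (λ j → A₀ j * c j) ⟩
      ∑ℚ (suc k) (λ j → x j₀ * (A₀ j * c j))    ≡⟨ ∑-cong (suc k) (λ j → solve 3 (λ a b c → a :* (b :* c) := b :* (a :* c)) refl (x j₀) (A₀ j) (c j)) ⟩
      ∑ℚ (suc k) (λ j → A₀ j * (x j₀ * c j))    ≡⟨ ∑-cong (suc k) (λ j → cong (A₀ j *_) (x∝c j)) ⟩
      ∑ℚ (suc k) (λ j → A₀ j * (c j₀ * x j))    ≡⟨ ∑-cong (suc k) (λ j → solve 3 (λ a b c → a :* (b :* c) := b :* (a :* c)) refl (A₀ j) (c j₀) (x j)) ⟩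
      ∑ℚ (suc k) (λ j → c j₀ * (A₀ j * x j))    ≡⟨ *-distribˡ-∑ (suc k) (c j₀) (λ j → A₀ j * x j) ⟨
      c j₀ * ∑ℚ (suc k) (λ j → A₀ j * x j)      ≡⟨ cong (c j₀ *_) (Ax≡0 zero) ⟩
      c j₀ * 0ℚ                                 ≡⟨ ℚP.*-zeroʳ (c j₀) ⟩
      0ℚ                                           ∎

  private
    zero-∷-kernel : ∀ {r m} (A : Matrix r (suc m)) → NonzeroKernel (λ i → A i ∘ suc) → NonzeroKernel A
    zero-∷-kernel {m = m} A (z , Az≡0 , t , zₜ≢0) = (0ℚ ∷ z) , Az′≡0 , suc t , zₜ≢0
      where
      Az′≡0 : InKerℚ A (0ℚ ∷ z)
      Az′≡0 i = begin
        toℚ (A i zero) * 0ℚ + rest   ≡⟨ cong (_+ rest) (ℚP.*-zeroʳ (toℚ (A i zero))) ⟩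
        0ℚ + rest                    ≡⟨ ℚP.+-identityˡ rest ⟩
        rest                         ≡⟨ Az≡0 i ⟩
        0ℚ                           ∎
        where rest = ∑ℚ m (λ j → toℚ (A i (suc j)) * z j)

    -- The rows ρ are nonsingular on the columns 1 … m.  Adjoining any row i keeps them
    -- nonsingular unless det (A i ∷ B) = A i · c vanishes for the cofactors c of B; if
    -- that happens for every i, c is a kernel vector of A with c 0 ≠ 0 (here B = A ∘ ρ).
    extend-rows : ∀ {r m} (A : Matrix r (suc m)) → NonsingularRows (λ i → A i ∘ suc) →
                  NonsingularRows A ⊎ NonzeroKernel A
    extend-rows {r} {m} A (ρ , ρ-injective , D≢0) with all? (λ i → det (suc m) (A i ∷ A ∘ ρ) ℤP.≟ + 0)
    ... | yes det≡0 = inj₂ (toℚ ∘ cofactor (A ∘ ρ) , Ac≡0 , zero , c₀≢0 ∘ toℚ-injective)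
      where
      Ac≡0 : InKerℚ A (toℚ ∘ cofactor (A ∘ ρ))
      Ac≡0 i = trans (sym (toℚ-homo-dot (suc m) (A i) (cofactor (A ∘ ρ))))
                     (cong toℚ (trans (sym (det-∷ m (A i) (A ∘ ρ))) (det≡0 i)))
      c₀≢0 : cofactor (A ∘ ρ) zero ≢ + 0
      c₀≢0 c₀≡0 = D≢0 (trans (sym (cofactor-zero (A ∘ ρ))) c₀≡0)
    ... | no det≢0 with ¬∀⟶∃¬ r _ (λ i → det (suc m) (A i ∷ A ∘ ρ) ℤP.≟ + 0) det≢0
    ...   | i , detᵢ≢0 = inj₁ (i ∷ ρ , ∷-injective , detᵢ≢0)
      where
      ∷-injective : Injective _≡_ _≡_ (i ∷ ρ)
      ∷-injective {zero} {zero} _ = refl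
      ∷-injective {suc a} {suc b} ρa≡ρb = cong suc (ρ-injective ρa≡ρb)
      ∷-injective {zero} {suc b} i≡ρb = ⊥-elim (detᵢ≢0 (det-equalRows m (A i ∷ A ∘ ρ) b (λ j → cong (λ q → A q j) i≡ρb)))
      ∷-injective {suc a} {zero} ρa≡i = ⊥-elim (detᵢ≢0 (det-equalRows m (A i ∷ A ∘ ρ) a (λ j → cong (λ q → A q j) (sym ρa≡i))))

  nonsingularRows⊎nonzeroKernel : ∀ {r} m (A : Matrix r m) → NonsingularRows A ⊎ NonzeroKernel A
  nonsingularRows⊎nonzeroKernel zero A = inj₁ ((λ ()) , (λ { {()} }) , λ ())
  nonsingularRows⊎nonzeroKernel (suc m) A with nonsingularRows⊎nonzeroKernel m (λ i → A i ∘ suc)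
  ... | inj₁ rows = extend-rows A rows
  ... | inj₂ kernel = inj₂ (zero-∷-kernel A kernel)

open Kernels

module Signs where

  open import Data.Rational using (_<_; _≤_)

  pos*pos>0 : ∀ {p q} → 0ℚ < p → 0ℚ < q → 0ℚ < p * q
  pos*pos>0 {p} {q} p>0 q>0 = ℚP.positive⁻¹ (p * q) {{ℚP.pos*pos⇒pos p {{ℚ.positive p>0}} q {{ℚ.positive q>0}}}}

  neg*neg>0 : ∀ {p q} → p < 0ℚ → q < 0ℚ → 0ℚ < p * q
  neg*neg>0 {p} {q} p<0 q<0 = ℚP.positive⁻¹ (p * q) {{ℚP.neg*neg⇒pos p {{ℚ.negative p<0}} q {{ℚ.negative q<0}}}}

  pos*neg<0 : ∀ {p q} → 0ℚ < p → q < 0ℚ → p * q < 0ℚ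
  pos*neg<0 {p} {q} p>0 q<0 = ℚP.negative⁻¹ (p * q) {{ℚP.pos*neg⇒neg p {{ℚ.positive p>0}} q {{ℚ.negative q<0}}}}

  neg*pos<0 : ∀ {p q} → p < 0ℚ → 0ℚ < q → p * q < 0ℚ
  neg*pos<0 {p} {q} p<0 q>0 = ℚP.negative⁻¹ (p * q) {{ℚP.neg*pos⇒neg p {{ℚ.negative p<0}} q {{ℚ.positive q>0}}}}

  >0⇒≢0 : ∀ {p} → 0ℚ < p → p ≢ 0ℚ
  >0⇒≢0 p>0 p≡0 = ℚP.<-irrefl (sym p≡0) p>0

  <0⇒≢0 : ∀ {p} → p < 0ℚ → p ≢ 0ℚ
  <0⇒≢0 p<0 p≡0 = ℚP.<-irrefl p≡0 p<0

  ≢0⇒>0⊎<0 : ∀ {p} → p ≢ 0ℚ → 0ℚ < p ⊎ p < 0ℚ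
  ≢0⇒>0⊎<0 {p} p≢0 with ℚP.<-cmp p 0ℚ
  ... | tri< p<0 _ _ = inj₂ p<0
  ... | tri≈ _ p≡0 _ = ⊥-elim (p≢0 p≡0)
  ... | tri> _ _ p>0 = inj₁ p>0

  ≥0∧≢0⇒>0 : ∀ {p} → 0ℚ ≤ p → p ≢ 0ℚ → 0ℚ < p
  ≥0∧≢0⇒>0 p≥0 p≢0 with ≢0⇒>0⊎<0 p≢0
  ... | inj₁ p>0 = p>0
  ... | inj₂ p<0 = ⊥-elim (ℚP.<-irrefl refl (ℚP.≤-<-trans p≥0 p<0))

  ≤0∧≢0⇒<0 : ∀ {p} → p ≤ 0ℚ → p ≢ 0ℚ → p < 0ℚ
  ≤0∧≢0⇒<0 p≤0 p≢0 with ≢0⇒>0⊎<0 p≢0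
  ... | inj₁ p>0 = ⊥-elim (ℚP.<-irrefl refl (ℚP.<-≤-trans p>0 p≤0))
  ... | inj₂ p<0 = p<0

  p≤q⇒0≤q-p : ∀ {p q} → p ≤ q → 0ℚ ≤ q - p
  p≤q⇒0≤q-p {p} {q} p≤q = subst (_≤ q - p) (ℚP.+-inverseʳ p) (ℚP.+-monoˡ-≤ (- p) p≤q)

  square>0 : ∀ {p} → p ≢ 0ℚ → 0ℚ < p * p
  square>0 p≢0 with ≢0⇒>0⊎<0 p≢0
  ... | inj₁ p>0 = pos*pos>0 p>0 p>0
  ... | inj₂ p<0 = neg*neg>0 p<0 p<0

  neg>0 : ∀ {p} → p < 0ℚ → 0ℚ < - p
  neg>0 = ℚP.neg-antimono-<

  neg<0 : ∀ {p} → 0ℚ < p → - p < 0ℚ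
  neg<0 = ℚP.neg-antimono-<

  pos*q>0⇒q>0 : ∀ {p q} → 0ℚ < p → 0ℚ < p * q → 0ℚ < q
  pos*q>0⇒q>0 {p} {q} p>0 pq>0 with ℚP.<-cmp q 0ℚ
  ... | tri< q<0 _ _ = ⊥-elim (ℚP.<-asym (pos*neg<0 p>0 q<0) pq>0)
  ... | tri≈ _ q≡0 _ = ⊥-elim (>0⇒≢0 pq>0 (trans (cong (p *_) q≡0) (ℚP.*-zeroʳ p)))
  ... | tri> _ _ q>0 = q>0

  neg*q>0⇒q<0 : ∀ {p q} → p < 0ℚ → 0ℚ < p * q → q < 0ℚ
  neg*q>0⇒q<0 {p} {q} p<0 pq>0 with ℚP.<-cmp q 0ℚ
  ... | tri< q<0 _ _ = q<0
  ... | tri≈ _ q≡0 _ = ⊥-elim (>0⇒≢0 pq>0 (trans (cong (p *_) q≡0) (ℚP.*-zeroʳ p)))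
  ... | tri> _ _ q>0 = ⊥-elim (ℚP.<-asym (neg*pos<0 p<0 q>0) pq>0)

  p-q>0⇒p>0 : ∀ {p q} → 0ℚ < p - q → 0ℚ ≤ q → 0ℚ < p
  p-q>0⇒p>0 {p} {q} p-q>0 q≥0 = subst (0ℚ <_) (solve 2 (λ p q → (p :- q) :+ q := p) refl p q) (ℚP.+-mono-<-≤ p-q>0 q≥0)

open Signs

module Elimination where

  open import Data.Rational using (_<_; _≤_)

  recip : ℚ → ℚ
  recip p with p ℚP.≟ 0ℚ
  ... | yes _ = 0ℚ
  ... | no p≢0 = ℚ.1/_ p {{ℚ.≢-nonZero p≢0}}

  *-recip : ∀ p → p ≢ 0ℚ → p * recip p ≡ 1ℚ
  *-recip p p≢0 with p ℚP.≟ 0ℚ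
  ... | yes p≡0 = ⊥-elim (p≢0 p≡0)
  ... | no p≢0 = ℚP.*-inverseʳ p {{ℚ.≢-nonZero p≢0}}

  minimiser : ∀ n (Q : Fin n → Set) → (∀ l → Dec (Q l)) → (g : Fin n → ℚ) →
              (∀ l → ¬ Q l) ⊎ ∃[ m ] (Q m × ∀ l → Q l → g m ≤ g l)
  minimiser zero Q Q? g = inj₁ (λ ())
  minimiser (suc n) Q Q? g with minimiser n (Q ∘ suc) (Q? ∘ suc) (g ∘ suc) | Q? zero
  ... | inj₁ none | no ¬q = inj₁ λ { zero → ¬q ; (suc l) → none l }
  ... | inj₁ none | yes q = inj₂ (zero , q , λ { zero _ → ℚP.≤-refl ; (suc l) q′ → ⊥-elim (none l q′) })
  ... | inj₂ (m , qₘ , min) | no ¬q = inj₂ (suc m , qₘ , λ { zero q → ⊥-elim (¬q q) ; (suc l) q′ → min l q′ })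
  ... | inj₂ (m , qₘ , min) | yes q with g zero ℚP.≤? g (suc m)
  ...   | yes g₀≤gₘ = inj₂ (zero , q , λ { zero _ → ℚP.≤-refl ; (suc l) q′ → ℚP.≤-trans g₀≤gₘ (min l q′) })
  ...   | no g₀≰gₘ = inj₂ (suc m , qₘ , λ { zero _ → ℚP.<⇒≤ (ℚP.≰⇒> g₀≰gₘ) ; (suc l) q′ → min l q′ })

  ConformalTo : ∀ {n} → (Fin n → ℚ) → (Fin n → ℚ) → Set
  ConformalTo {n} v u = ∀ l → v l ≢ 0ℚ → 0ℚ < v l * u l

  private
    sgn : ∀ {p} → 0ℚ < p ⊎ p < 0ℚ → ℚ
    sgn (inj₁ _) = 1ℚ
    sgn (inj₂ _) = - 1ℚ

    sgn*>0 : ∀ {p} (d : 0ℚ < p ⊎ p < 0ℚ) → 0ℚ < sgn d * p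
    sgn*>0 {p} (inj₁ p>0) = subst (0ℚ <_) (sym (ℚP.*-identityˡ p)) p>0
    sgn*>0 {p} (inj₂ p<0) = subst (0ℚ <_) (solve 1 (λ p → :- p := con (- 1ℚ) :* p) refl p) (neg>0 p<0)

    -- u′ = u − t W with t = min { u l / W l | W l u l > 0 } > 0
    module Step {n} (u W : Fin n → ℚ) (W≢0⇒u≢0 : ∀ l → W l ≢ 0ℚ → u l ≢ 0ℚ) (l₁ : Fin n) (Wuₗ₁>0 : 0ℚ < W l₁ * u l₁) where

      Q : Fin n → Set
      Q l = 0ℚ < W l * u l

      g : Fin n → ℚ
      g l = u l * recip (W l)

      g*Wu : ∀ l → W l ≢ 0ℚ → g l * (W l * u l) ≡ u l * u l
      g*Wu l Wₗ≢0 = begin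
        (u l * recip (W l)) * (W l * u l)   ≡⟨ solve 3 (λ u i w → (u :* i) :* (w :* u) := (u :* u) :* (w :* i)) refl (u l) (recip (W l)) (W l) ⟩
        (u l * u l) * (W l * recip (W l))   ≡⟨ cong ((u l * u l) *_) (*-recip (W l) Wₗ≢0) ⟩
        (u l * u l) * 1ℚ                    ≡⟨ ℚP.*-identityʳ (u l * u l) ⟩
        u l * u l                           ∎
        where open ≡-Reasoning

      minimum : ∃[ m ] (Q m × ∀ l → Q l → g m ≤ g l)
      minimum with minimiser n Q (λ l → 0ℚ ℚP.<? W l * u l) g
      ... | inj₁ none = ⊥-elim (none l₁ Wuₗ₁>0)
      ... | inj₂ found = found

      m = proj₁ minimum
      t = g m

      Wₘ≢0 : W m ≢ 0ℚ
      Wₘ≢0 Wₘ≡0 = >0⇒≢0 (proj₁ (proj₂ minimum)) (trans (cong (_* u m) Wₘ≡0) (ℚP.*-zeroˡ (u m)))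

      t>0 : 0ℚ < t
      t>0 = pos*q>0⇒q>0 (proj₁ (proj₂ minimum))
              (subst (0ℚ <_) (trans (sym (g*Wu m Wₘ≢0)) (ℚP.*-comm t _)) (square>0 (W≢0⇒u≢0 m Wₘ≢0)))

      u′ : Fin n → ℚ
      u′ l = u l - t * W l

      u′ₘ≡0 : u′ m ≡ 0ℚ
      u′ₘ≡0 = begin
        u m - (u m * recip (W m)) * W m   ≡⟨ solve 3 (λ u i w → u :- (u :* i) :* w := u :- u :* (w :* i)) refl (u m) (recip (W m)) (W m) ⟩
        u m - u m * (W m * recip (W m))   ≡⟨ cong (λ x → u m - u m * x) (*-recip (W m) Wₘ≢0) ⟩
        u m - u m * 1ℚ                    ≡⟨ solve 1 (λ u → u :- u :* con 1ℚ := con 0ℚ) refl (u m) ⟩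
        0ℚ                                ∎
        where open ≡-Reasoning

      u′u : ∀ l → u′ l * u l ≡ u l * u l - t * (W l * u l)
      u′u l = solve 3 (λ u t w → (u :- t :* w) :* u := u :* u :- t :* (w :* u)) refl (u l) t (W l)

      -- where W l u l > 0, the choice of m as minimiser gives u′ l u l = W l u l (g l − t) ≥ 0
      conformal : ConformalTo u′ u
      conformal l u′ₗ≢0 with W l ℚP.≟ 0ℚ | ℚP.<-cmp (W l * u l) 0ℚ
      ... | yes Wₗ≡0 | _ = subst (0ℚ <_) (cong (_* u l) (sym u′ₗ≡uₗ)) (square>0 (λ uₗ≡0 → u′ₗ≢0 (trans u′ₗ≡uₗ uₗ≡0)))
        where
        u′ₗ≡uₗ : u′ l ≡ u l
        u′ₗ≡uₗ = trans (cong (λ x → u l - t * x) Wₗ≡0) (solve 2 (λ u t → u :- t :* con 0ℚ := u) refl (u l) t)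
      ... | no Wₗ≢0 | tri< Wu<0 _ _ = subst (0ℚ <_) (sym (u′u l))
            (ℚP.+-mono-<-≤ (square>0 (W≢0⇒u≢0 l Wₗ≢0)) (ℚP.<⇒≤ (neg>0 (pos*neg<0 t>0 Wu<0))))
      ... | no Wₗ≢0 | tri≈ _ Wu≡0 _ = ⊥-elim (*-≢0 Wₗ≢0 (W≢0⇒u≢0 l Wₗ≢0) Wu≡0)
      ... | no Wₗ≢0 | tri> _ _ Wu>0 = ≥0∧≢0⇒>0 (subst (0ℚ ≤_) eq (p≤q⇒0≤q-p Wu·t≤Wu·gₗ)) (*-≢0 u′ₗ≢0 (W≢0⇒u≢0 l Wₗ≢0))
        where
        Wu·t≤Wu·gₗ : (W l * u l) * t ≤ (W l * u l) * g l
        Wu·t≤Wu·gₗ = ℚP.*-monoˡ-≤-nonNeg (W l * u l) {{ℚ.nonNegative (ℚP.<⇒≤ Wu>0)}} (proj₂ (proj₂ minimum) l Wu>0)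
        eq : (W l * u l) * g l - (W l * u l) * t ≡ u′ l * u l
        eq = trans (solve 3 (λ c g t → c :* g :- c :* t := g :* c :- t :* c) refl (W l * u l) (g l) t)
                   (trans (cong (_- t * (W l * u l)) (g*Wu l Wₗ≢0)) (sym (u′u l)))

  -- Step for W = ± Z, with the sign chosen so that W l₁ u l₁ > 0
  elimination : ∀ {n} (u Z : Fin n → ℚ) → (∀ l → Z l ≢ 0ℚ → u l ≢ 0ℚ) → ∀ l₁ → Z l₁ ≢ 0ℚ →
                ∃[ τ ] ∃[ m ] (Z m ≢ 0ℚ × u m - τ * Z m ≡ 0ℚ × ConformalTo (λ l → u l - τ * Z l) u)
  elimination u Z Z⊆u l₁ Zₗ₁≢0 = t * σ , m , Zₘ≢0 , trans (shift m) u′ₘ≡0 , λ l → subst (λ x → x ≢ 0ℚ → 0ℚ < x * u l) (sym (shift l)) (conformal l)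
    where
    sign₁ : 0ℚ < Z l₁ * u l₁ ⊎ Z l₁ * u l₁ < 0ℚ
    sign₁ = ≢0⇒>0⊎<0 (*-≢0 Zₗ₁≢0 (Z⊆u l₁ Zₗ₁≢0))
    σ : ℚ
    σ = sgn sign₁
    σZ≢0⇒Z≢0 : ∀ l → σ * Z l ≢ 0ℚ → Z l ≢ 0ℚ
    σZ≢0⇒Z≢0 l σZₗ≢0 Zₗ≡0 = σZₗ≢0 (trans (cong (σ *_) Zₗ≡0) (ℚP.*-zeroʳ σ))
    open Step u (λ l → σ * Z l) (λ l → Z⊆u l ∘ σZ≢0⇒Z≢0 l) l₁ (subst (0ℚ <_) (sym (ℚP.*-assoc σ (Z l₁) (u l₁))) (sgn*>0 sign₁))
    shift : ∀ l → u l - (t * σ) * Z l ≡ u′ l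
    shift l = cong (λ x → u l - x) (ℚP.*-assoc t σ (Z l))
    Zₘ≢0 : Z m ≢ 0ℚ
    Zₘ≢0 = σZ≢0⇒Z≢0 m Wₘ≢0

open Elimination using (ConformalTo; elimination; recip; *-recip)

module Unimodular where

  IsUnit : ℤ → Set
  IsUnit z = z ≡ + 1 ⊎ z ≡ ℤ.- + 1

  altSign-unit : ∀ {k} (j : Fin k) → IsUnit (altSign j)
  altSign-unit zero = inj₁ refl
  altSign-unit (suc j) with altSign-unit j
  ... | inj₁ sⱼ≡1 = inj₂ (cong ℤ.-_ sⱼ≡1)
  ... | inj₂ sⱼ≡-1 = inj₁ (cong ℤ.-_ sⱼ≡-1)

  unit*-Is01 : ∀ {a b} → IsUnit a → Is01 b → Is01 (a ℤ.* b)
  unit*-Is01 {b = b} (inj₁ refl) b∈01 = subst Is01 (sym (ℤP.*-identityˡ b)) b∈01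
  unit*-Is01 (inj₂ refl) (inj₁ refl) = inj₁ refl
  unit*-Is01 (inj₂ refl) (inj₂ (inj₁ refl)) = inj₂ (inj₂ refl)
  unit*-Is01 (inj₂ refl) (inj₂ (inj₂ refl)) = inj₂ (inj₁ refl)

  cofactor-Is01 : ∀ {r n} (M : Matrix r n) → TotallyUnimodular M → ∀ {k} (ρ : Fin k → Fin r) (κ : Fin (suc k) → Fin n) →
                  Injective _≡_ _≡_ ρ → Injective _≡_ _≡_ κ → ∀ t → Is01 (cofactor (λ a b → M (ρ a) (κ b)) t)
  cofactor-Is01 M TU {k} ρ κ ρ-injective κ-injective t =
    unit*-Is01 (altSign-unit t) (TU k ρ (κ ∘ punchIn t) ρ-injective (λ eq → punchIn-injective t _ _ (κ-injective eq)))

open Unimodular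

module Conformality where

  open import Data.Rational using (_<_)

  Conformal : ∀ {n} → Fourientation n → (Fin n → ℚ) → Set
  Conformal {n} F u = ∀ j → (0ℚ < u j → F (j , true)) × (u j < 0ℚ → F (j , false))

  same-sign : ∀ {a b x y} → a * x ≡ b * y → 0ℚ < a * b → (0ℚ < x → 0ℚ < y) × (x < 0ℚ → y < 0ℚ)
  same-sign {a} {b} {x} {y} ax≡by ab>0 = (λ x>0 → pos*q>0⇒q>0 ab>0 (subst (0ℚ <_) eq (pos*pos>0 a²>0 x>0)))
                                        , (λ x<0 → neg*q>0⇒q<0 (neg<0 ab>0) (subst (0ℚ <_) eq′ (pos*pos>0 a²>0 (neg>0 x<0))))
    where
    a≢0 : a ≢ 0ℚ
    a≢0 a≡0 = >0⇒≢0 ab>0 (trans (cong (_* b) a≡0) (ℚP.*-zeroˡ b))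
    a²>0 = square>0 a≢0
    eq : (a * a) * x ≡ (a * b) * y
    eq = trans (ℚP.*-assoc a a x) (trans (cong (a *_) ax≡by) (sym (ℚP.*-assoc a b y)))
    eq′ : (a * a) * (- x) ≡ (- (a * b)) * y
    eq′ = trans (solve 3 (λ a x y → (a :* a) :* (:- x) := :- (a :* (a :* x))) refl a x y)
            (trans (cong (λ z → - (a * z)) ax≡by) (solve 3 (λ a b y → :- (a :* (b :* y)) := (:- (a :* b)) :* y) refl a b y))

  ConformalTo-Conformal : ∀ {n} {F : Fourientation n} {u v} → ConformalTo v u → Conformal F u → Conformal F v
  ConformalTo-Conformal v⊑u u-conformal l =
    (λ vₗ>0 → proj₁ (u-conformal l) (pos*q>0⇒q>0 vₗ>0 (v⊑u l (>0⇒≢0 vₗ>0)))) ,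
    (λ vₗ<0 → proj₂ (u-conformal l) (neg*q>0⇒q<0 vₗ<0 (v⊑u l (<0⇒≢0 vₗ<0))))

open Conformality

-- If the rows ρ are nonsingular on the columns κ₀ ⊇ supp u ∖ {e}, the cofactors of
-- B = M[ρ, e ∷ κ₀] form a {0, ±1} vector V in ker M (total unimodularity), and every
-- kernel vector supported on e ∷ κ₀ is a multiple of V; so supp V is a circuit, and V
-- oriented like u at e is a potential circuit of F through e.
module CofactorCircuit {r n} (M : Matrix r n) (TU : TotallyUnimodular M) (F : Fourientation n) (e : Fin n)
  (u : Fin n → ℚ) (Mu≡0 : InKerℚ M u) (uₑ≢0 : u e ≢ 0ℚ) (u-conformal : Conformal F u)
  {s} (κ₀ : Fin s → Fin n) (κ₀-injective : Injective _≡_ _≡_ κ₀) (κ₀≢e : ∀ t → κ₀ t ≢ e)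
  (u-outside : ℚΣ.VanishesOutside (e ∷ κ₀) u) (rows : NonsingularRows (λ i t → M i (κ₀ t))) where

  open import Data.Rational using (_<_)

  open ≡-Reasoning

  κ : Fin (suc s) → Fin n
  κ = e ∷ κ₀

  κ-injective : Injective _≡_ _≡_ κ
  κ-injective {zero} {zero} _ = refl
  κ-injective {zero} {suc b} e≡κ₀b = ⊥-elim (κ₀≢e b (sym e≡κ₀b))
  κ-injective {suc a} {zero} κ₀a≡e = ⊥-elim (κ₀≢e a κ₀a≡e)
  κ-injective {suc a} {suc b} κ₀a≡κ₀b = cong suc (κ₀-injective κ₀a≡κ₀b)

  ρ = proj₁ rows
  ρ-injective = proj₁ (proj₂ rows)

  B : Matrix s (suc s)
  B a t = M (ρ a) (κ t)

  V : Fin n → ℤ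
  V = ℤΣ.push κ (cofactor B)

  Vq : Fin n → ℚ
  Vq = toℚ ∘ V

  Vₑ≢0 : Vq e ≢ 0ℚ
  Vₑ≢0 Vₑ≡0 = proj₂ (proj₂ rows) (begin
    det s (λ a b → M (ρ a) (κ₀ b)) ≡⟨ cofactor-zero B ⟨
    cofactor B zero                ≡⟨ ℤΣ.push-at κ κ-injective (cofactor B) zero ⟨
    V e                            ≡⟨ toℚ-injective Vₑ≡0 ⟩
    + 0                            ∎)

  V-Is01 : ∀ l → Is01 (V l)
  V-Is01 l with any? (λ t → κ t ≟ l)
  ... | yes (t , refl) = subst Is01 (sym (ℤΣ.push-at κ κ-injective (cofactor B) t)) (cofactor-Is01 M TU ρ κ ρ-injective κ-injective t)
  ... | no l∉κ = inj₁ (ℤΣ.push-vanishesOutside κ (cofactor B) l (λ t κₜ≡l → l∉κ (t , κₜ≡l)))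

  -- each M i · V is a determinant with first row M i restricted to κ and the rows ρ below;
  -- u restricted to κ is a kernel vector of that matrix, nonzero at e
  MV≡0 : ∀ i → ∑ℤ n (λ j → M i j ℤ.* V j) ≡ + 0
  MV≡0 i = begin
    ∑ℤ n (λ j → M i j ℤ.* V j)                         ≡⟨ ℤΣ.push-dot n κ (cofactor B) (M i) ⟩
    ∑ℤ (suc s) (λ t → M i (κ t) ℤ.* cofactor B t)      ≡⟨ det-∷ s (M i ∘ κ) B ⟨
    det (suc s) (M i ∘ κ ∷ B)                          ≡⟨ nonzeroKernel⇒det≡0 (suc s) (M i ∘ κ ∷ B) (u ∘ κ , restricted , zero , uₑ≢0) ⟩
    + 0                                                ∎
    where
    restricted : InKerℚ (M i ∘ κ ∷ B) (u ∘ κ)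
    restricted zero = trans (sym (ℚΣ.∑-restrict n κ κ-injective u (toℚ ∘ M i) u-outside)) (Mu≡0 i)
    restricted (suc a) = trans (sym (ℚΣ.∑-restrict n κ κ-injective u (toℚ ∘ M (ρ a)) u-outside)) (Mu≡0 (ρ a))

  MVq≡0 : InKerℚ M Vq
  MVq≡0 i = trans (sym (toℚ-homo-dot n (M i) V)) (cong toℚ (MV≡0 i))

  private
    combination : (Fin n → ℚ) → Fin n → ℚ
    combination w l = w e * Vq l + (- Vq e) * w l

    combination-outside : ∀ w → ℚΣ.VanishesOutside κ w → ℚΣ.VanishesOutside κ₀ (combination w)
    combination-outside w w-outside l l∉κ₀ with l ≟ e
    ... | yes refl = solve 2 (λ a b → a :* b :+ (:- b) :* a := con 0ℚ) refl (w e) (Vq e)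
    ... | no l≢e = begin
      w e * Vq l + (- Vq e) * w l    ≡⟨ cong₂ (λ x y → w e * x + (- Vq e) * y) (cong toℚ (ℤΣ.push-vanishesOutside κ (cofactor B) l l∉κ)) (w-outside l l∉κ) ⟩
      w e * 0ℚ + (- Vq e) * 0ℚ      ≡⟨ solve 2 (λ a b → a :* con 0ℚ :+ b :* con 0ℚ := con 0ℚ) refl (w e) (- Vq e) ⟩
      0ℚ                            ∎
      where
      l∉κ : ∀ t → κ t ≢ l
      l∉κ zero e≡l = l≢e (sym e≡l)
      l∉κ (suc t) = l∉κ₀ t

  -- w e · V − V e · w lives on κ₀, where the rows ρ are nonsingular
  proportional : ∀ w → InKerℚ M w → ℚΣ.VanishesOutside κ w → ∀ l → w e * Vq l ≡ Vq e * w l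
  proportional w Mw≡0 w-outside l with all? (λ t → combination w (κ₀ t) ℚP.≟ 0ℚ)
  ... | no z≢0 = ⊥-elim (proj₂ (proj₂ rows)
        (nonzeroKernel⇒det≡0 s _ (combination w ∘ κ₀ , Mz≡0 , ¬∀⟶∃¬ s _ (λ t → combination w (κ₀ t) ℚP.≟ 0ℚ) z≢0)))
    where
    Mz≡0 : InKerℚ (λ a t → M (ρ a) (κ₀ t)) (combination w ∘ κ₀)
    Mz≡0 a = trans (sym (ℚΣ.∑-restrict n κ₀ κ₀-injective (combination w) (toℚ ∘ M (ρ a)) (combination-outside w w-outside)))
                   (InKerℚ-lincomb M (w e) (- Vq e) MVq≡0 Mw≡0 (ρ a))
  ... | yes z∘κ₀≡0 = begin
    w e * Vq l                       ≡⟨ solve 3 (λ a v b → a := (a :+ (:- v) :* b) :+ v :* b) refl (w e * Vq l) (Vq e) (w l) ⟩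
    combination w l + Vq e * w l     ≡⟨ cong (_+ Vq e * w l) z≡0 ⟩
    0ℚ + Vq e * w l                  ≡⟨ ℚP.+-identityˡ (Vq e * w l) ⟩
    Vq e * w l                       ∎
    where
    z≡0 : combination w l ≡ 0ℚ
    z≡0 with any? (λ t → κ₀ t ≟ l)
    ... | yes (t , refl) = z∘κ₀≡0 t
    ... | no l∉κ₀ = combination-outside w w-outside l (λ t κ₀ₜ≡l → l∉κ₀ (t , κ₀ₜ≡l))

  private
    sgn : ∀ {p} → 0ℚ < p ⊎ p < 0ℚ → ℤ
    sgn (inj₁ _) = + 1
    sgn (inj₂ _) = ℤ.- + 1

    sgn-unit : ∀ {p} (d : 0ℚ < p ⊎ p < 0ℚ) → IsUnit (sgn d)
    sgn-unit (inj₁ _) = inj₁ refl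
    sgn-unit (inj₂ _) = inj₂ refl

    sgn*>0 : ∀ {p} (d : 0ℚ < p ⊎ p < 0ℚ) → 0ℚ < toℚ (sgn d) * p
    sgn*>0 {p} (inj₁ p>0) = subst (0ℚ <_) (sym (ℚP.*-identityˡ p)) p>0
    sgn*>0 {p} (inj₂ p<0) = subst (0ℚ <_) (solve 1 (λ p → :- p := con (- 1ℚ) :* p) refl p) (neg>0 p<0)

  module Oriented (σ : ℤ) (σ-unit : IsUnit σ) (σVu>0 : 0ℚ < toℚ σ * (Vq e * u e)) where

    v : Fin n → ℤ
    v l = σ ℤ.* V l

    vq : Fin n → ℚ
    vq = toℚ ∘ v

    vq≡σVq : ∀ l → vq l ≡ toℚ σ * Vq l
    vq≡σVq l = toℚ-homo-* σ (V l)

    v≢0⇒V≢0 : ∀ l → v l ≢ + 0 → V l ≢ + 0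
    v≢0⇒V≢0 l vₗ≢0 Vₗ≡0 = vₗ≢0 (trans (cong (σ ℤ.*_) Vₗ≡0) (ℤP.*-zeroʳ σ))

    vuₑ>0 : 0ℚ < vq e * u e
    vuₑ>0 = subst (0ℚ <_) (trans (sym (ℚP.*-assoc (toℚ σ) (Vq e) (u e))) (cong (_* u e) (sym (vq≡σVq e)))) σVu>0

    vₑ≢0 : v e ≢ + 0
    vₑ≢0 vₑ≡0 = >0⇒≢0 vuₑ>0 (trans (cong (λ x → toℚ x * u e) vₑ≡0) (ℚP.*-zeroˡ (u e)))

    v-Is01 : ∀ l → Is01 (v l)
    v-Is01 l = unit*-Is01 σ-unit (V-Is01 l)

    Mv≡0 : ∀ i → ∑ℤ n (λ j → M i j ℤ.* v j) ≡ + 0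
    Mv≡0 i = begin
      ∑ℤ n (λ j → M i j ℤ.* (σ ℤ.* V j))   ≡⟨ ℤΣ.∑-cong n (λ j → ℤP.*-comm (M i j) (σ ℤ.* V j)) ⟩
      ∑ℤ n (λ j → (σ ℤ.* V j) ℤ.* M i j)   ≡⟨ ℤΣ.∑-cong n (λ j → trans (ℤP.*-assoc σ (V j) (M i j)) (cong (σ ℤ.*_) (ℤP.*-comm (V j) (M i j)))) ⟩
      ∑ℤ n (λ j → σ ℤ.* (M i j ℤ.* V j))   ≡⟨ ℤΣ.*-distribˡ-∑ n σ (λ j → M i j ℤ.* V j) ⟨
      σ ℤ.* ∑ℤ n (λ j → M i j ℤ.* V j)     ≡⟨ cong (σ ℤ.*_) (MV≡0 i) ⟩
      σ ℤ.* + 0                            ≡⟨ ℤP.*-zeroʳ σ ⟩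
      + 0                                  ∎

    Mvq≡0 : InKerℚ M vq
    Mvq≡0 i = trans (sym (toℚ-homo-dot n (M i) v)) (cong toℚ (Mv≡0 i))

    u∝v : ∀ l → u e * vq l ≡ vq e * u l
    u∝v l = begin
      u e * vq l                   ≡⟨ cong (u e *_) (vq≡σVq l) ⟩
      u e * (toℚ σ * Vq l)         ≡⟨ solve 3 (λ a s b → a :* (s :* b) := s :* (a :* b)) refl (u e) (toℚ σ) (Vq l) ⟩
      toℚ σ * (u e * Vq l)         ≡⟨ cong (toℚ σ *_) (proportional u Mu≡0 u-outside′ l) ⟩
      toℚ σ * (Vq e * u l)         ≡⟨ ℚP.*-assoc (toℚ σ) (Vq e) (u l) ⟨
      (toℚ σ * Vq e) * u l         ≡⟨ cong (_* u l) (vq≡σVq e) ⟨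
      vq e * u l                   ∎
      where
      u-outside′ : ℚΣ.VanishesOutside κ u
      u-outside′ = u-outside

    arcs⊆F : ∀ a → arcsOf v a → F a
    arcs⊆F (l , true) vₗ≡1 = proj₁ (u-conformal l)
      (proj₁ (same-sign {u e} {vq e} {vq l} {u l} (u∝v l) (subst (0ℚ <_) (ℚP.*-comm (vq e) (u e)) vuₑ>0)) (subst (0ℚ <_) (sym (cong toℚ vₗ≡1)) (ℚP.positive⁻¹ 1ℚ)))
    arcs⊆F (l , false) vₗ≡-1 = proj₂ (u-conformal l)
      (proj₂ (same-sign {u e} {vq e} {vq l} {u l} (u∝v l) (subst (0ℚ <_) (ℚP.*-comm (vq e) (u e)) vuₑ>0)) (subst (_< 0ℚ) (sym (cong toℚ vₗ≡-1)) (neg<0 (ℚP.positive⁻¹ 1ℚ))))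

    -- a kernel vector supported inside supp v is a multiple of V, so its support is all of supp v
    minimal : ∀ (X : Subset n) → (∀ l → X l → supp v l) → Dependent M X → ∀ l → supp v l → X l
    minimal X X⊆v (w , Mw≡0 , (l₀ , wₗ₀≢0) , w⊆X) l vₗ≢0 with w l ℚP.≟ 0ℚ
    ... | no wₗ≢0 = w⊆X l wₗ≢0
    ... | yes wₗ≡0 = ⊥-elim (*-≢0 wₑ≢0 (Vₗ≢0 ∘ toℚ-injective) (trans (w∝V l) (trans (cong (Vq e *_) wₗ≡0) (ℚP.*-zeroʳ (Vq e)))))
      where
      Vₗ≢0 = v≢0⇒V≢0 l vₗ≢0
      w-outside : ℚΣ.VanishesOutside κ w
      w-outside l l∉κ with w l ℚP.≟ 0ℚ
      ... | yes wₗ≡0 = wₗ≡0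
      ... | no wₗ≢0 = ⊥-elim (v≢0⇒V≢0 l (X⊆v l (w⊆X l wₗ≢0)) (ℤΣ.push-vanishesOutside κ (cofactor B) l l∉κ))
      w∝V = proportional w Mw≡0 w-outside
      wₑ≢0 : w e ≢ 0ℚ
      wₑ≢0 wₑ≡0 = wₗ₀≢0 (p*q≡0⇒q≡0 (Vq e) (w l₀) (trans (sym (w∝V l₀)) (trans (cong (_* Vq l₀) wₑ≡0) (ℚP.*-zeroˡ (Vq l₀)))) Vₑ≢0)

    potentialCircuit : InPotentialCircuit M F e
    potentialCircuit = v , (v-Is01 , Mv≡0 , dependent , minimal) , arcs⊆F , vₑ≢0
      where
      dependent : Dependent M (supp v)
      dependent = vq , Mvq≡0 , (e , vₑ≢0 ∘ toℚ-injective) , (λ l vqₗ≢0 vₗ≡0 → vqₗ≢0 (cong toℚ vₗ≡0))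

  potentialCircuit : InPotentialCircuit M F e
  potentialCircuit = Oriented.potentialCircuit (sgn orientation) (sgn-unit orientation) (sgn*>0 orientation)
    where
    orientation : 0ℚ < Vq e * u e ⊎ Vq e * u e < 0ℚ
    orientation = ≢0⇒>0⊎<0 (*-≢0 Vₑ≢0 uₑ≢0)

vanishesOutside-punchIn : ∀ {n s} {e : Fin n} {κ₀ : Fin (suc s) → Fin n} {w} t →
  ℚΣ.VanishesOutside (e ∷ κ₀) w → w (κ₀ t) ≡ 0ℚ → ℚΣ.VanishesOutside (e ∷ κ₀ ∘ punchIn t) w
vanishesOutside-punchIn {κ₀ = κ₀} {w} t w-outside wₜ≡0 l l∉ with κ₀ t ≟ l
... | yes refl = wₜ≡0
... | no κ₀ₜ≢l = w-outside l l∉′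
  where
  l∉′ : ∀ t′ → (_ ∷ κ₀) t′ ≢ l
  l∉′ zero = l∉ zero
  l∉′ (suc t′) with t′ ≟ t
  ... | yes refl = κ₀ₜ≢l
  ... | no t′≢t = subst (λ x → κ₀ x ≢ l) (punchIn-punchOut (t′≢t ∘ sym)) (l∉ (suc (punchOut (t′≢t ∘ sym))))

module ConformalDecomposition {r n} (M : Matrix r n) (TU : TotallyUnimodular M) (F : Fourientation n) (e : Fin n) where


  record ConformalKernelVector : Set where
    field
      vector : Fin n → ℚ
      in-kernel : InKerℚ M vector
      nonzero-at-e : vector e ≢ 0ℚ
      conformal : Conformal F vector

  open ConformalKernelVector

  private
    injective-∘punchIn : ∀ {s} (κ₀ : Fin (suc s) → Fin n) → Injective _≡_ _≡_ κ₀ → ∀ t → Injective _≡_ _≡_ (κ₀ ∘ punchIn t)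
    injective-∘punchIn κ₀ κ₀-injective t eq = punchIn-injective t _ _ (κ₀-injective eq)

    shift : (u : ConformalKernelVector) (Z : Fin n → ℚ) → InKerℚ M Z → Z e ≡ 0ℚ →
            ∀ τ → ConformalTo (λ l → vector u l - τ * Z l) (vector u) → ConformalKernelVector
    shift u Z MZ≡0 Zₑ≡0 τ u′⊑u = record
      { vector = λ l → vector u l - τ * Z l
      ; in-kernel = InKerℚ-cong M (λ j → solve 3 (λ u t z → con 1ℚ :* u :+ (:- t) :* z := u :- t :* z) refl (vector u j) τ (Z j))
                      (InKerℚ-lincomb M 1ℚ (- τ) (in-kernel u) MZ≡0)
      ; nonzero-at-e = λ u′ₑ≡0 → nonzero-at-e u (trans (solve 2 (λ u t → u := u :- t :* con 0ℚ) refl (vector u e) τ)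
                                                    (trans (cong (λ x → vector u e - τ * x) (sym Zₑ≡0)) u′ₑ≡0))
      ; conformal = ConformalTo-Conformal {F = F} u′⊑u (conformal u)
      }

    -- move u along Z = push κ₀ z (which is supported inside supp u and vanishes at e)
    -- until it loses a coordinate κ₀ t₀
    eliminate : ∀ {s} (κ₀ : Fin (suc s) → Fin n) → Injective _≡_ _≡_ κ₀ → (∀ t → κ₀ t ≢ e) →
      (u : ConformalKernelVector) → ℚΣ.VanishesOutside (e ∷ κ₀) (vector u) → (∀ t → vector u (κ₀ t) ≢ 0ℚ) →
      NonzeroKernel (λ i t → M i (κ₀ t)) →
      ∃[ t₀ ] Σ ConformalKernelVector (λ u′ → ℚΣ.VanishesOutside (e ∷ κ₀ ∘ punchIn t₀) (vector u′))
    eliminate {s} κ₀ κ₀-injective κ₀≢e u u-outside u∘κ₀≢0 (z , Mz≡0 , t₁ , zₜ₁≢0) =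
      finish (elimination (vector u) Z Z⊆u (κ₀ t₁) (λ Zₜ₁≡0 → zₜ₁≢0 (trans (sym (ℚΣ.push-at κ₀ κ₀-injective z t₁)) Zₜ₁≡0)))
      where
      Z : Fin n → ℚ
      Z = ℚΣ.push κ₀ z
      Z⊆u : ∀ l → Z l ≢ 0ℚ → vector u l ≢ 0ℚ
      Z⊆u l Zₗ≢0 with any? (λ t → κ₀ t ≟ l)
      ... | yes (t , refl) = u∘κ₀≢0 t
      ... | no l∉κ₀ = ⊥-elim (Zₗ≢0 (ℚΣ.push-vanishesOutside κ₀ z l (λ t κ₀ₜ≡l → l∉κ₀ (t , κ₀ₜ≡l))))
      finish : ∃[ τ ] ∃[ m ] (Z m ≢ 0ℚ × vector u m - τ * Z m ≡ 0ℚ × ConformalTo (λ l → vector u l - τ * Z l) (vector u)) →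
               ∃[ t₀ ] Σ ConformalKernelVector (λ u′ → ℚΣ.VanishesOutside (e ∷ κ₀ ∘ punchIn t₀) (vector u′))
      finish (τ , m , Zₘ≢0 , u′ₘ≡0 , u′⊑u) with any? (λ t → κ₀ t ≟ m)
      ... | no m∉κ₀ = ⊥-elim (Zₘ≢0 (ℚΣ.push-vanishesOutside κ₀ z m (λ t κ₀ₜ≡m → m∉κ₀ (t , κ₀ₜ≡m))))
      ... | yes (t₀ , refl) = t₀ , shift u Z MZ≡0 (ℚΣ.push-vanishesOutside κ₀ z e κ₀≢e) τ u′⊑u ,
                              vanishesOutside-punchIn t₀ u′-outside u′ₘ≡0
        where
        MZ≡0 : InKerℚ M Z
        MZ≡0 i = trans (ℚΣ.push-dot n κ₀ z (toℚ ∘ M i)) (Mz≡0 i)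
        u′-outside : ℚΣ.VanishesOutside (e ∷ κ₀) (λ l → vector u l - τ * Z l)
        u′-outside l l∉ = begin
          vector u l - τ * Z l     ≡⟨ cong₂ (λ x y → x - τ * y) (u-outside l l∉) (ℚΣ.push-vanishesOutside κ₀ z l (l∉ ∘ suc)) ⟩
          0ℚ - τ * 0ℚ              ≡⟨ solve 1 (λ t → con 0ℚ :- t :* con 0ℚ := con 0ℚ) refl τ ⟩
          0ℚ                       ∎
          where open ≡-Reasoning

  potentialCircuit-on : ∀ s (κ₀ : Fin s → Fin n) → Injective _≡_ _≡_ κ₀ → (∀ t → κ₀ t ≢ e) →
    (u : ConformalKernelVector) → ℚΣ.VanishesOutside (e ∷ κ₀) (vector u) → InPotentialCircuit M F e
  potentialCircuit-on s κ₀ κ₀-injective κ₀≢e u u-outside with nonsingularRows⊎nonzeroKernel s (λ i t → M i (κ₀ t))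
  ... | inj₁ rows = CofactorCircuit.potentialCircuit M TU F e (vector u) (in-kernel u) (nonzero-at-e u) (conformal u)
                      κ₀ κ₀-injective κ₀≢e u-outside rows
  potentialCircuit-on zero κ₀ _ _ _ _ | inj₂ (_ , _ , () , _)
  potentialCircuit-on (suc s) κ₀ κ₀-injective κ₀≢e u u-outside | inj₂ kernel with any? (λ t → vector u (κ₀ t) ℚP.≟ 0ℚ)
  ... | yes (t , uₜ≡0) = potentialCircuit-on s (κ₀ ∘ punchIn t) (injective-∘punchIn κ₀ κ₀-injective t) (κ₀≢e ∘ punchIn t)
                           u (vanishesOutside-punchIn t u-outside uₜ≡0)
  ... | no u∘κ₀≢0 =
    let t₀ , u′ , u′-outside = eliminate κ₀ κ₀-injective κ₀≢e u u-outside (λ t uₜ≡0 → u∘κ₀≢0 (t , uₜ≡0)) kernel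
    in potentialCircuit-on s (κ₀ ∘ punchIn t₀) (injective-∘punchIn κ₀ κ₀-injective t₀) (κ₀≢e ∘ punchIn t₀) u′ u′-outside

conformal⇒potentialCircuit : ∀ {r n} (M : Matrix r n) → TotallyUnimodular M → (F : Fourientation n) (e : Fin n) →
  (u : Fin n → ℚ) → InKerℚ M u → u e ≢ 0ℚ → Conformal F u → InPotentialCircuit M F e
conformal⇒potentialCircuit {n = suc n} M TU F e u Mu≡0 uₑ≢0 u-conformal =
  potentialCircuit-on n (punchIn e) (λ eq → punchIn-injective e _ _ eq) (punchInᵢ≢i e)
    (record { vector = u ; in-kernel = Mu≡0 ; nonzero-at-e = uₑ≢0 ; conformal = u-conformal }) nothing-outside
  where
  open ConformalDecomposition M TU F e
  nothing-outside : ℚΣ.VanishesOutside (e ∷ punchIn e) u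
  nothing-outside l l∉ with l ≟ e
  ... | yes refl = ⊥-elim (l∉ zero refl)
  ... | no l≢e = ⊥-elim (l∉ (suc (punchOut (l≢e ∘ sym))) (punchIn-punchOut (l≢e ∘ sym)))

module LawrenceCoordinates {r n} (M : Matrix r n) where

  open ℚΣ
  open ≡-Reasoning

  lawrenceVertex-lower : ∀ i b j → lawrenceVertex M (i , b) (inj₂ j) ≡ δ i j
  lawrenceVertex-lower i true j with i ≟ j
  ... | yes _ = refl
  ... | no _ = refl
  lawrenceVertex-lower i false j with i ≟ j
  ... | yes _ = refl
  ... | no _ = refl

  combo-lower : ∀ (c : Arc n → ℚ) j → combo M c (inj₂ j) ≡ c (j , true) + c (j , false)
  combo-lower c j = cong₂ _+_ (select true) (select false)
    where
    select : ∀ b → ∑ℚ n (λ i → c (i , b) * lawrenceVertex M (i , b) (inj₂ j)) ≡ c (j , b)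
    select b = begin
      ∑ℚ n (λ i → c (i , b) * lawrenceVertex M (i , b) (inj₂ j)) ≡⟨ ∑-cong n (λ i → cong (c (i , b) *_) (lawrenceVertex-lower i b j)) ⟩
      ∑ℚ n (λ i → c (i , b) * δ i j)                            ≡⟨ ∑-cong n (λ i → trans (cong (c (i , b) *_) (δ-cong {i = i} {j} {j} {i} sym sym)) (ℚP.*-comm (c (i , b)) (δ j i))) ⟩
      ∑ℚ n (λ i → δ j i * c (i , b))                            ≡⟨ ∑-δ n j (λ i → c (i , b)) ⟩
      c (j , b)                                                  ∎

  combo-upper : ∀ (c : Arc n → ℚ) k → combo M c (inj₁ k) ≡ ∑ℚ n (λ i → toℚ (M k i) * c (i , true))
  combo-upper c k = begin
    ∑ℚ n (λ i → c (i , true) * toℚ (M k i)) + ∑ℚ n (λ i → c (i , false) * 0ℚ)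
      ≡⟨ cong₂ _+_ (∑-cong n (λ i → ℚP.*-comm (c (i , true)) (toℚ (M k i)))) (∑-zero n (λ i → ℚP.*-zeroʳ (c (i , false)))) ⟩
    ∑ℚ n (λ i → toℚ (M k i) * c (i , true)) + 0ℚ
      ≡⟨ ℚP.+-identityʳ _ ⟩
    ∑ℚ n (λ i → toℚ (M k i) * c (i , true)) ∎

  ∑Arc-scale : ∀ t (c : Arc n → ℚ) → ∑Arc n (λ a → t * c a) ≡ t * ∑Arc n c
  ∑Arc-scale t c = trans (cong₂ _+_ (sym (*-distribˡ-∑ n t (λ i → c (i , true)))) (sym (*-distribˡ-∑ n t (λ i → c (i , false)))))
                         (sym (ℚP.*-distribˡ-+ t _ _))

  combo-scale : ∀ t (c : Arc n → ℚ) y → combo M (λ a → t * c a) y ≡ t * combo M c y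
  combo-scale t c y = trans (cong₂ _+_ (∑-cong n (λ i → ℚP.*-assoc t _ _)) (∑-cong n (λ i → ℚP.*-assoc t _ _)))
                            (∑Arc-scale t (λ a → c a * lawrenceVertex M a y))

module RelativeInteriorCoefficients {n} (I : Arc n → Bool) (c : Arc n → ℚ)
  (c>0 : ∀ a → I a ≡ true → 0ℚ ℚ.< c a) (c≡0 : ∀ a → I a ≡ false → c a ≡ 0ℚ) where

  open import Data.Rational using (_<_; _≤_)

  c≥0 : ∀ a → 0ℚ ≤ c a
  c≥0 a with I a in Iₐ
  ... | true = ℚP.<⇒≤ (c>0 a Iₐ)
  ... | false = ℚP.≤-reflexive (sym (c≡0 a Iₐ))

  c>0⇒I : ∀ a → 0ℚ < c a → I a ≡ true
  c>0⇒I a cₐ>0 with I a in Iₐ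
  ... | true = refl
  ... | false = ⊥-elim (>0⇒≢0 cₐ>0 (c≡0 a Iₐ))

  edge-weight>0 : ∀ e → EdgesOf (χ I) e ⇔ 0ℚ < c (e , true) + c (e , false)
  edge-weight>0 e = mk⇔
    (λ { (inj₁ I₊) → ℚP.+-mono-<-≤ (c>0 _ I₊) (c≥0 _)
       ; (inj₂ I₋) → ℚP.+-mono-≤-< (c≥0 _) (c>0 _ I₋) })
    λ weight>0 → case (e , true) (e , false) weight>0
    where
    case : ∀ a₊ a₋ → 0ℚ < c a₊ + c a₋ → χ I a₊ ⊎ χ I a₋
    case a₊ a₋ weight>0 with I a₊ in I₊ | I a₋ in I₋
    ... | true | _ = inj₁ refl
    ... | false | true = inj₂ refl
    ... | false | false = ⊥-elim (>0⇒≢0 weight>0 (cong₂ _+_ (c≡0 a₊ I₊) (c≡0 a₋ I₋)))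

module Forward {r n} (M : Matrix r n) (I₁ I₂ : Arc n → Bool) (x : Point r n)
  (c₁ : Arc n → ℚ) (c₁>0 : ∀ a → I₁ a ≡ true → 0ℚ ℚ.< c₁ a) (c₁≡0 : ∀ a → I₁ a ≡ false → c₁ a ≡ 0ℚ) (c₁↦x : ∀ y → combo M c₁ y ≡ x y)
  (c₂ : Arc n → ℚ) (c₂>0 : ∀ a → I₂ a ≡ true → 0ℚ ℚ.< c₂ a) (c₂≡0 : ∀ a → I₂ a ≡ false → c₂ a ≡ 0ℚ) (c₂↦x : ∀ y → combo M c₂ y ≡ x y) where

  open import Data.Rational using (_<_)

  open LawrenceCoordinates M
  open ≡-Reasoning
  open import Algebra.Properties.Group ℚP.+-0-group using (x∙y⁻¹≈ε⇒x≈y)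
  module C₁ = RelativeInteriorCoefficients I₁ c₁ c₁>0 c₁≡0
  module C₂ = RelativeInteriorCoefficients I₂ c₂ c₂>0 c₂≡0

  F : Fourientation n
  F = χ I₁ ∩neg χ I₂

  edge-weights : ∀ j → c₁ (j , true) + c₁ (j , false) ≡ c₂ (j , true) + c₂ (j , false)
  edge-weights j = trans (sym (combo-lower c₁ j)) (trans (c₁↦x (inj₂ j)) (trans (sym (c₂↦x (inj₂ j))) (combo-lower c₂ j)))

  same-edges : ∀ e → EdgesOf (χ I₁) e ⇔ EdgesOf (χ I₂) e
  same-edges e = mk⇔
    (λ e∈F₁ → Equivalence.from (C₂.edge-weight>0 e) (subst (0ℚ <_) (edge-weights e) (Equivalence.to (C₁.edge-weight>0 e) e∈F₁)))
    (λ e∈F₂ → Equivalence.from (C₁.edge-weight>0 e) (subst (0ℚ <_) (sym (edge-weights e)) (Equivalence.to (C₂.edge-weight>0 e) e∈F₂)))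

  w : Fin n → ℚ
  w j = c₁ (j , true) - c₂ (j , true)

  w≡ : ∀ j → w j ≡ c₂ (j , false) - c₁ (j , false)
  w≡ j = begin
    c₁₊ - c₂₊                                 ≡⟨ solve 4 (λ a b c d → a :- c := ((a :+ b) :- (c :+ d)) :+ (d :- b)) refl c₁₊ c₁₋ c₂₊ c₂₋ ⟩
    ((c₁₊ + c₁₋) - (c₂₊ + c₂₋)) + (c₂₋ - c₁₋) ≡⟨ cong (λ s → (s - (c₂₊ + c₂₋)) + (c₂₋ - c₁₋)) (edge-weights j) ⟩
    ((c₂₊ + c₂₋) - (c₂₊ + c₂₋)) + (c₂₋ - c₁₋) ≡⟨ solve 3 (λ s a b → (s :- s) :+ (a :- b) := a :- b) refl (c₂₊ + c₂₋) c₂₋ c₁₋ ⟩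
    c₂₋ - c₁₋                                 ∎
    where
    c₁₊ = c₁ (j , true); c₁₋ = c₁ (j , false); c₂₊ = c₂ (j , true); c₂₋ = c₂ (j , false)

  Mw≡0 : InKerℚ M w
  Mw≡0 k = begin
    ∑ℚ n (λ i → Mₖ i * (c₁ (i , true) - c₂ (i , true)))
      ≡⟨ ℚΣ.∑-cong n (λ i → solve 3 (λ m a b → m :* (a :- b) := m :* a :+ con (- 1ℚ) :* (m :* b)) refl (Mₖ i) (c₁ (i , true)) (c₂ (i , true))) ⟩
    ∑ℚ n (λ i → Mₖ i * c₁ (i , true) + - 1ℚ * (Mₖ i * c₂ (i , true)))
      ≡⟨ ℚΣ.∑-distrib-+ n _ _ ⟩
    ∑ℚ n (λ i → Mₖ i * c₁ (i , true)) + ∑ℚ n (λ i → - 1ℚ * (Mₖ i * c₂ (i , true)))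
      ≡⟨ cong (_+_ (∑ℚ n (λ i → Mₖ i * c₁ (i , true)))) (ℚΣ.*-distribˡ-∑ n (- 1ℚ) (λ i → Mₖ i * c₂ (i , true))) ⟨
    ∑ℚ n (λ i → Mₖ i * c₁ (i , true)) + - 1ℚ * ∑ℚ n (λ i → Mₖ i * c₂ (i , true))
      ≡⟨ cong₂ (λ a b → a + - 1ℚ * b) (trans (sym (combo-upper c₁ k)) (c₁↦x (inj₁ k))) (trans (sym (combo-upper c₂ k)) (c₂↦x (inj₁ k))) ⟩
    x (inj₁ k) + - 1ℚ * x (inj₁ k)
      ≡⟨ solve 1 (λ a → a :+ con (- 1ℚ) :* a := con 0ℚ) refl (x (inj₁ k)) ⟩
    0ℚ ∎
    where
    Mₖ : Fin n → ℚ
    Mₖ i = toℚ (M k i)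

  w-conformal : Conformal F w
  w-conformal j = (λ wⱼ>0 → C₁.c>0⇒I _ (p-q>0⇒p>0 wⱼ>0 (C₂.c≥0 _)) ,
                            C₂.c>0⇒I _ (p-q>0⇒p>0 (subst (0ℚ <_) (w≡ j) wⱼ>0) (C₁.c≥0 _)))
                , (λ wⱼ<0 → C₁.c>0⇒I (j , false) (p-q>0⇒p>0 (subst (0ℚ <_) (neg-sub (c₂ (j , false)) (c₁ (j , false)) (w≡ j)) (neg>0 wⱼ<0)) (C₂.c≥0 (j , false))) ,
                            C₂.c>0⇒I (j , true) (p-q>0⇒p>0 (subst (0ℚ <_) (neg-sub (c₁ (j , true)) (c₂ (j , true)) refl) (neg>0 wⱼ<0)) (C₁.c≥0 (j , true))))
    where
    neg-sub : ∀ {p} a b → p ≡ a - b → - p ≡ b - a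
    neg-sub a b refl = solve 2 (λ a b → :- (a :- b) := b :- a) refl a b

  transfer₁₂ : ∀ a → c₁ a ≡ c₂ a → I₁ a ≡ true → I₂ a ≡ true
  transfer₁₂ a c₁≡c₂ I₁ₐ = C₂.c>0⇒I a (subst (0ℚ <_) c₁≡c₂ (c₁>0 a I₁ₐ))

  transfer₂₁ : ∀ a → c₁ a ≡ c₂ a → I₂ a ≡ true → I₁ a ≡ true
  transfer₂₁ a c₁≡c₂ I₂ₐ = C₁.c>0⇒I a (subst (0ℚ <_) (sym c₁≡c₂) (c₂>0 a I₂ₐ))

  w≡0⇒agree₊ : ∀ {e} → w e ≡ 0ℚ → c₁ (e , true) ≡ c₂ (e , true)
  w≡0⇒agree₊ = x∙y⁻¹≈ε⇒x≈y _ _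

  w≡0⇒agree₋ : ∀ {e} → w e ≡ 0ℚ → c₁ (e , false) ≡ c₂ (e , false)
  w≡0⇒agree₋ {e} wₑ≡0 = sym (x∙y⁻¹≈ε⇒x≈y _ _ (trans (sym (w≡ e)) wₑ≡0))

  -- if w e = 0, then c₁ and c₂ agree on both arcs of e, hence so do I₁ and I₂, and then
  -- an arc of e lies in F exactly when its reverse does
  oneWay⇒w≢0 : ∀ e → OneWay F e → w e ≢ 0ℚ
  oneWay⇒w≢0 e (inj₁ (F₊ , ¬F₋)) wₑ≡0 =
    ¬F₋ (transfer₂₁ (e , false) (w≡0⇒agree₋ wₑ≡0) (proj₂ F₊) , transfer₁₂ (e , true) (w≡0⇒agree₊ wₑ≡0) (proj₁ F₊))
  oneWay⇒w≢0 e (inj₂ (F₋ , ¬F₊)) wₑ≡0 =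
    ¬F₊ (transfer₂₁ (e , true) (w≡0⇒agree₊ wₑ≡0) (proj₂ F₋) , transfer₁₂ (e , false) (w≡0⇒agree₋ wₑ≡0) (proj₁ F₋))

module PositivePart where

  open import Data.Rational using (_<_; _≤_)

  _⁺ : ℚ → ℚ
  w ⁺ = w ℚ.⊔ 0ℚ

  ⁺-≥0 : ∀ w → 0ℚ ≤ w ⁺
  ⁺-≥0 w = ℚP.p≤q⊔p w 0ℚ

  ⁺-≤0 : ∀ {w} → w ≤ 0ℚ → w ⁺ ≡ 0ℚ
  ⁺-≤0 = ℚP.p≤q⇒p⊔q≡q

  ⁺->0 : ∀ {w} → 0ℚ < w → 0ℚ < w ⁺
  ⁺->0 w>0 = subst (0ℚ <_) (sym (ℚP.p≥q⇒p⊔q≡p (ℚP.<⇒≤ w>0))) w>0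

  ⁺-⁻ : ∀ w → w ⁺ - (- w) ⁺ ≡ w
  ⁺-⁻ w with ℚP.≤-total w 0ℚ
  ... | inj₁ w≤0 = trans (cong₂ _-_ (⁺-≤0 w≤0) (ℚP.p≥q⇒p⊔q≡p (ℚP.neg-antimono-≤ w≤0))) (solve 1 (λ w → con 0ℚ :- (:- w) := w) refl w)
  ... | inj₂ w≥0 = trans (cong₂ _-_ (ℚP.p≥q⇒p⊔q≡p w≥0) (⁺-≤0 (ℚP.neg-antimono-≤ w≥0))) (solve 1 (λ w → w :- con 0ℚ := w) refl w)

open PositivePart

module ArcCoefficients where

  open import Data.Rational using (_≤_; _<_)

  indicator : Bool → ℚ
  indicator true = 1ℚ
  indicator false = 0ℚ

  indicator≥0 : ∀ b → 0ℚ ≤ indicator b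
  indicator≥0 true = ℚP.<⇒≤ (ℚP.positive⁻¹ 1ℚ)
  indicator≥0 false = ℚP.≤-refl

  -- The coefficient of an arc α in the constructed representation: a and b record whether α
  -- and its reverse are vertices of S₁, c and d the same for S₂, so that α ∈ F iff a ∧ d and
  -- its reverse is in F iff b ∧ c; w is the component of the circuit sum W along α.
  arc-coefficient : ∀ (a b c d : Bool) w → (¬ (a ≡ true × d ≡ true) → w ≤ 0ℚ) →
    (a ≡ true × d ≡ true → ¬ (b ≡ true × c ≡ true) → 0ℚ < w) → (a ≡ true ⊎ b ≡ true → c ≡ true ⊎ d ≡ true) →
    (a ≡ true → 0ℚ < indicator (a Data.Bool.∧ c) + w ⁺) × (a ≡ false → indicator (a Data.Bool.∧ c) + w ⁺ ≡ 0ℚ)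
  arc-coefficient false b c d w w≤0 _ _ = (λ ()) , λ _ → trans (ℚP.+-identityˡ (w ⁺)) (⁺-≤0 (w≤0 (λ { (() , _) })))
  arc-coefficient true b true d w _ _ _ = (λ _ → ℚP.+-mono-<-≤ (ℚP.positive⁻¹ 1ℚ) (⁺-≥0 w)) , λ ()
  arc-coefficient true b false d w _ w>0 edges = (λ _ → subst (0ℚ <_) (sym (ℚP.+-identityˡ (w ⁺))) (⁺->0 (w>0 (refl , d≡true) λ { (_ , ()) }))) , λ ()
    where
    d≡true : d ≡ true
    d≡true with edges (inj₁ refl)
    ... | inj₂ d≡true = d≡true

open ArcCoefficients

module SignedSums where

  open import Data.Rational using (_<_; _≤_)

  open ℚΣ

  ∑-nonneg : ∀ k (f : Fin k → ℚ) → (∀ i → 0ℚ ≤ f i) → 0ℚ ≤ ∑ℚ k f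
  ∑-nonneg zero f f≥0 = ℚP.≤-refl
  ∑-nonneg (suc k) f f≥0 = ℚP.+-mono-≤ (f≥0 zero) (∑-nonneg k (f ∘ suc) (f≥0 ∘ suc))

  ∑-nonpos : ∀ k (f : Fin k → ℚ) → (∀ i → f i ≤ 0ℚ) → ∑ℚ k f ≤ 0ℚ
  ∑-nonpos zero f f≤0 = ℚP.≤-refl
  ∑-nonpos (suc k) f f≤0 = ℚP.+-mono-≤ (f≤0 zero) (∑-nonpos k (f ∘ suc) (f≤0 ∘ suc))

  ∑-pos : ∀ k (f : Fin k → ℚ) → (∀ i → 0ℚ ≤ f i) → ∀ i → 0ℚ < f i → 0ℚ < ∑ℚ k f
  ∑-pos (suc k) f f≥0 i fᵢ>0 =
    subst (0ℚ <_) (sym (∑-remove k f i)) (ℚP.+-mono-<-≤ fᵢ>0 (∑-nonneg k (f ∘ punchIn i) (f≥0 ∘ punchIn i)))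

  ∑-neg : ∀ k (f : Fin k → ℚ) → (∀ i → f i ≤ 0ℚ) → ∀ i → f i < 0ℚ → ∑ℚ k f < 0ℚ
  ∑-neg (suc k) f f≤0 i fᵢ<0 =
    subst (_< 0ℚ) (sym (∑-remove k f i)) (ℚP.+-mono-<-≤ fᵢ<0 (∑-nonpos k (f ∘ punchIn i) (f≤0 ∘ punchIn i)))

open SignedSums

module Backward {r n} (M : Matrix r n) (I₁ I₂ : Arc n → Bool) (S₁-nonempty : ∃[ a ] I₁ a ≡ true)
  (same-edges : ∀ e → EdgesOf (χ I₁) e ⇔ EdgesOf (χ I₂) e)
  (circuits : ∀ e → OneWay (χ I₁ ∩neg χ I₂) e → InPotentialCircuit M (χ I₁ ∩neg χ I₂) e) where

  open import Data.Rational using (_<_; _≤_)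

  open ≡-Reasoning

  F : Fourientation n
  F = χ I₁ ∩neg χ I₂

  oneWay? : ∀ e → Dec (OneWay F e)
  oneWay? e = (F? (e , true) ×-dec ¬? (F? (e , false))) ⊎-dec (F? (e , false) ×-dec ¬? (F? (e , true)))
    where
    F? : ∀ a → Dec (F a)
    F? a = (I₁ a Data.Bool.≟ true) ×-dec (I₂ (negArc a) Data.Bool.≟ true)

  Compatible : (Fin n → ℚ) → Set
  Compatible w = ∀ j → (¬ F (j , true) → w j ≤ 0ℚ) × (¬ F (j , false) → 0ℚ ≤ w j)

  circuit-compatible : ∀ (v : Fin n → ℤ) → (∀ j → Is01 (v j)) → (∀ a → arcsOf v a → F a) → Compatible (toℚ ∘ v)
  circuit-compatible v v∈01 v⊆F j with v∈01 j
  ... | inj₁ vⱼ≡0 = (λ _ → ℚP.≤-reflexive (cong toℚ vⱼ≡0)) , (λ _ → ℚP.≤-reflexive (sym (cong toℚ vⱼ≡0)))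
  ... | inj₂ (inj₁ vⱼ≡1) = (λ ¬F₊ → ⊥-elim (¬F₊ (v⊆F (j , true) vⱼ≡1)))
                         , (λ _ → subst (0ℚ ≤_) (sym (cong toℚ vⱼ≡1)) (ℚP.<⇒≤ (ℚP.positive⁻¹ 1ℚ)))
  ... | inj₂ (inj₂ vⱼ≡-1) = (λ _ → subst (_≤ 0ℚ) (sym (cong toℚ vⱼ≡-1)) (ℚP.<⇒≤ (neg<0 (ℚP.positive⁻¹ 1ℚ))))
                          , (λ ¬F₋ → ⊥-elim (¬F₋ (v⊆F (j , false) vⱼ≡-1)))

  circuitThrough : ∀ e → Dec (OneWay F e) → Fin n → ℚ
  circuitThrough e (yes one-way) = toℚ ∘ proj₁ (circuits e one-way)
  circuitThrough e (no _) _ = 0ℚ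

  circuitThrough-compatible : ∀ e d → Compatible (circuitThrough e d)
  circuitThrough-compatible e (yes one-way) with circuits e one-way
  ... | v , (v∈01 , _) , v⊆F , _ = circuit-compatible v v∈01 v⊆F
  circuitThrough-compatible e (no _) j = (λ _ → ℚP.≤-refl) , (λ _ → ℚP.≤-refl)

  circuitThrough-kernel : ∀ e d → InKerℚ M (circuitThrough e d)
  circuitThrough-kernel e (yes one-way) i with circuits e one-way
  ... | v , (_ , Mv≡0 , _) , _ = trans (sym (toℚ-homo-dot n (M i) v)) (cong toℚ (Mv≡0 i))
  circuitThrough-kernel e (no _) i = ℚΣ.∑-zero n (λ j → ℚP.*-zeroʳ (toℚ (M i j)))

  circuitThrough-≢0 : ∀ e (d : Dec (OneWay F e)) → OneWay F e → circuitThrough e d e ≢ 0ℚ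
  circuitThrough-≢0 e (yes one-way) _ with circuits e one-way
  ... | _ , _ , _ , vₑ≢0 = vₑ≢0 ∘ toℚ-injective
  circuitThrough-≢0 e (no ¬one-way) one-way = ⊥-elim (¬one-way one-way)

  W : Fin n → ℚ
  W j = ∑ℚ n (λ e → circuitThrough e (oneWay? e) j)

  W-compatible : Compatible W
  W-compatible j = (λ ¬F₊ → ∑-nonpos n _ (λ e → proj₁ (circuitThrough-compatible e (oneWay? e) j) ¬F₊))
                 , (λ ¬F₋ → ∑-nonneg n _ (λ e → proj₂ (circuitThrough-compatible e (oneWay? e) j) ¬F₋))

  W-pos : ∀ j → F (j , true) → ¬ F (j , false) → 0ℚ < W j
  W-pos j F₊ ¬F₋ = ∑-pos n _ (λ e → proj₂ (circuitThrough-compatible e (oneWay? e) j) ¬F₋) j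
    (≥0∧≢0⇒>0 (proj₂ (circuitThrough-compatible j (oneWay? j) j) ¬F₋) (circuitThrough-≢0 j (oneWay? j) (inj₁ (F₊ , ¬F₋))))

  W-neg : ∀ j → F (j , false) → ¬ F (j , true) → W j < 0ℚ
  W-neg j F₋ ¬F₊ = ∑-neg n _ (λ e → proj₁ (circuitThrough-compatible e (oneWay? e) j) ¬F₊) j
    (≤0∧≢0⇒<0 (proj₁ (circuitThrough-compatible j (oneWay? j) j) ¬F₊) (circuitThrough-≢0 j (oneWay? j) (inj₂ (F₋ , ¬F₊))))

  MW≡0 : InKerℚ M W
  MW≡0 k = begin
    ∑ℚ n (λ j → Mₖ j * ∑ℚ n (λ e → g e j))   ≡⟨ ℚΣ.∑-cong n (λ j → ℚΣ.*-distribˡ-∑ n (Mₖ j) (λ e → g e j)) ⟩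
    ∑ℚ n (λ j → ∑ℚ n (λ e → Mₖ j * g e j))   ≡⟨ ℚΣ.∑-comm n n (λ j e → Mₖ j * g e j) ⟩
    ∑ℚ n (λ e → ∑ℚ n (λ j → Mₖ j * g e j))   ≡⟨ ℚΣ.∑-zero n (λ e → circuitThrough-kernel e (oneWay? e) k) ⟩
    0ℚ                                         ∎
    where
    Mₖ : Fin n → ℚ
    Mₖ j = toℚ (M k j)
    g : Fin n → Fin n → ℚ
    g e = circuitThrough e (oneWay? e)

  open LawrenceCoordinates M
  open Equivalence using (to; from)
  open Data.Bool using (_∧_)

  -- unnormalised barycentric coordinates of the common point with respect to S₁ and S₂
  μ₁ μ₂ : Arc n → ℚ
  μ₁ (j , true) = indicator (I₁ (j , true) ∧ I₂ (j , true)) + W j ⁺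
  μ₁ (j , false) = indicator (I₁ (j , false) ∧ I₂ (j , false)) + (- W j) ⁺
  μ₂ (j , true) = indicator (I₂ (j , true) ∧ I₁ (j , true)) + (- W j) ⁺
  μ₂ (j , false) = indicator (I₂ (j , false) ∧ I₁ (j , false)) + W j ⁺

  private
    swap⊎ : ∀ {A B : Set} → A ⊎ B → B ⊎ A
    swap⊎ = Data.Sum.swap
    swap× : ∀ {A B : Set} → A × B → B × A
    swap× = Data.Product.swap

    μ₁-pattern : ∀ a → (I₁ a ≡ true → 0ℚ < μ₁ a) × (I₁ a ≡ false → μ₁ a ≡ 0ℚ)
    μ₁-pattern (j , true) = arc-coefficient _ _ _ _ (W j) (proj₁ (W-compatible j)) (W-pos j) (to (same-edges j))
    μ₁-pattern (j , false) = arc-coefficient _ _ _ _ (- W j) (ℚP.neg-antimono-≤ ∘ proj₂ (W-compatible j))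
      (λ F₋ ¬F₊ → neg>0 (W-neg j F₋ ¬F₊)) (swap⊎ ∘ to (same-edges j) ∘ swap⊎)

    μ₂-pattern : ∀ a → (I₂ a ≡ true → 0ℚ < μ₂ a) × (I₂ a ≡ false → μ₂ a ≡ 0ℚ)
    μ₂-pattern (j , true) = arc-coefficient _ _ _ _ (- W j) (ℚP.neg-antimono-≤ ∘ proj₂ (W-compatible j) ∘ (_∘ swap×))
      (λ F₋ ¬F₊ → neg>0 (W-neg j (swap× F₋) (¬F₊ ∘ swap×))) (from (same-edges j))
    μ₂-pattern (j , false) = arc-coefficient _ _ _ _ (W j) (proj₁ (W-compatible j) ∘ (_∘ swap×))
      (λ F₊ ¬F₋ → W-pos j (swap× F₊) (¬F₋ ∘ swap×)) (swap⊎ ∘ from (same-edges j) ∘ swap⊎)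

  μ₁≥0 : ∀ a → 0ℚ ≤ μ₁ a
  μ₁≥0 (j , true) = ℚP.+-mono-≤ (indicator≥0 (I₁ (j , true) ∧ I₂ (j , true))) (⁺-≥0 (W j))
  μ₁≥0 (j , false) = ℚP.+-mono-≤ (indicator≥0 (I₁ (j , false) ∧ I₂ (j , false))) (⁺-≥0 (- W j))

  edge-weights : ∀ j → μ₂ (j , true) + μ₂ (j , false) ≡ μ₁ (j , true) + μ₁ (j , false)
  edge-weights j rewrite Data.Bool.Properties.∧-comm (I₂ (j , true)) (I₁ (j , true))
                       | Data.Bool.Properties.∧-comm (I₂ (j , false)) (I₁ (j , false)) =
    solve 4 (λ a b p q → (a :+ q) :+ (b :+ p) := (a :+ p) :+ (b :+ q)) refl
      (indicator (I₁ (j , true) ∧ I₂ (j , true))) (indicator (I₁ (j , false) ∧ I₂ (j , false))) (W j ⁺) ((- W j) ⁺)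

  -- on the arcs e⁺, μ₁ − μ₂ = W⁺ − W⁻ = W, which lies in ker M
  same-combo : ∀ y → combo M μ₂ y ≡ combo M μ₁ y
  same-combo (inj₂ j) = trans (combo-lower μ₂ j) (trans (edge-weights j) (sym (combo-lower μ₁ j)))
  same-combo (inj₁ k) = begin
    combo M μ₂ (inj₁ k)                                          ≡⟨ combo-upper μ₂ k ⟩
    ∑ℚ n (λ i → Mₖ i * μ₂ (i , true))                            ≡⟨ ℚP.+-identityʳ _ ⟨
    ∑ℚ n (λ i → Mₖ i * μ₂ (i , true)) + 0ℚ                       ≡⟨ cong (_+_ (∑ℚ n (λ i → Mₖ i * μ₂ (i , true)))) (MW≡0 k) ⟨
    ∑ℚ n (λ i → Mₖ i * μ₂ (i , true)) + ∑ℚ n (λ i → Mₖ i * W i)  ≡⟨ ℚΣ.∑-distrib-+ n _ _ ⟨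
    ∑ℚ n (λ i → Mₖ i * μ₂ (i , true) + Mₖ i * W i)               ≡⟨ ℚΣ.∑-cong n (λ i → trans (sym (ℚP.*-distribˡ-+ (Mₖ i) _ _)) (cong (Mₖ i *_) (split i))) ⟩
    ∑ℚ n (λ i → Mₖ i * μ₁ (i , true))                            ≡⟨ combo-upper μ₁ k ⟨
    combo M μ₁ (inj₁ k)                                          ∎
    where
    Mₖ : Fin n → ℚ
    Mₖ i = toℚ (M k i)
    split : ∀ i → μ₂ (i , true) + W i ≡ μ₁ (i , true)
    split i rewrite Data.Bool.Properties.∧-comm (I₂ (i , true)) (I₁ (i , true)) = begin
      (a + (- W i) ⁺) + W i                     ≡⟨ cong (λ w → (a + (- W i) ⁺) + w) (⁺-⁻ (W i)) ⟨
      (a + (- W i) ⁺) + (W i ⁺ - (- W i) ⁺)     ≡⟨ solve 3 (λ a p q → (a :+ q) :+ (p :- q) := a :+ p) refl a (W i ⁺) ((- W i) ⁺) ⟩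
      a + W i ⁺                                 ∎
      where a = indicator (I₁ (i , true) ∧ I₂ (i , true))

  T : ℚ
  T = ∑Arc n μ₁

  T>0 : 0ℚ < T
  T>0 = positive S₁-nonempty
    where
    positive : ∃[ a ] I₁ a ≡ true → 0ℚ < T
    positive ((j , true) , I₁ₐ) = ℚP.+-mono-<-≤ (∑-pos n _ (λ i → μ₁≥0 (i , true)) j (proj₁ (μ₁-pattern (j , true)) I₁ₐ))
                                                (∑-nonneg n _ (λ i → μ₁≥0 (i , false)))
    positive ((j , false) , I₁ₐ) = ℚP.+-mono-≤-< (∑-nonneg n _ (λ i → μ₁≥0 (i , true)))
                                                 (∑-pos n _ (λ i → μ₁≥0 (i , false)) j (proj₁ (μ₁-pattern (j , false)) I₁ₐ))

  ∑μ₂≡T : ∑Arc n μ₂ ≡ T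
  ∑μ₂≡T = begin
    ∑ℚ n (λ i → μ₂ (i , true)) + ∑ℚ n (λ i → μ₂ (i , false))   ≡⟨ ℚΣ.∑-distrib-+ n _ _ ⟨
    ∑ℚ n (λ i → μ₂ (i , true) + μ₂ (i , false))                ≡⟨ ℚΣ.∑-cong n edge-weights ⟩
    ∑ℚ n (λ i → μ₁ (i , true) + μ₁ (i , false))                ≡⟨ ℚΣ.∑-distrib-+ n _ _ ⟩
    T                                                          ∎

  T⁻¹ : ℚ
  T⁻¹ = recip T

  T⁻¹>0 : 0ℚ < T⁻¹
  T⁻¹>0 = pos*q>0⇒q>0 T>0 (subst (0ℚ <_) (sym (*-recip T (>0⇒≢0 T>0))) (ℚP.positive⁻¹ 1ℚ))

  normalised : ∀ {μ} → ∑Arc n μ ≡ T → ∑Arc n (λ a → T⁻¹ * μ a) ≡ 1ℚ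
  normalised {μ} ∑μ≡T = trans (∑Arc-scale T⁻¹ μ) (trans (cong (T⁻¹ *_) ∑μ≡T) (trans (ℚP.*-comm T⁻¹ T) (*-recip T (>0⇒≢0 T>0))))

  x : Point r n
  x = combo M (λ a → T⁻¹ * μ₁ a)

  relint₁ : InRelInt M I₁ x
  relint₁ = (λ a → T⁻¹ * μ₁ a)
          , (λ a I₁ₐ → pos*pos>0 T⁻¹>0 (proj₁ (μ₁-pattern a) I₁ₐ))
          , (λ a ¬I₁ₐ → trans (cong (T⁻¹ *_) (proj₂ (μ₁-pattern a) ¬I₁ₐ)) (ℚP.*-zeroʳ T⁻¹))
          , normalised {μ₁} refl
          , (λ y → refl)

  relint₂ : InRelInt M I₂ x
  relint₂ = (λ a → T⁻¹ * μ₂ a)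
          , (λ a I₂ₐ → pos*pos>0 T⁻¹>0 (proj₁ (μ₂-pattern a) I₂ₐ))
          , (λ a ¬I₂ₐ → trans (cong (T⁻¹ *_) (proj₂ (μ₂-pattern a) ¬I₂ₐ)) (ℚP.*-zeroʳ T⁻¹))
          , normalised {μ₂} ∑μ₂≡T
          , (λ y → trans (combo-scale T⁻¹ μ₂ y) (trans (cong (T⁻¹ *_) (same-combo y)) (sym (combo-scale T⁻¹ μ₁ y))))

open import Data.Nat using (_<_)

lemma4p11 : ∀ {r n} (M : Matrix r n) → 0 < r → TotallyUnimodular M → HasFullRowRank M →
            Loopless M → (I₁ I₂ : Arc n → Bool) → IsSimplex M I₁ → IsSimplex M I₂ →
            (∃[ x ] (InRelInt M I₁ x × InRelInt M I₂ x))
            ⇔ ((∀ e → EdgesOf (χ I₁) e ⇔ EdgesOf (χ I₂) e)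
               × (∀ e → OneWay (χ I₁ ∩neg χ I₂) e → InPotentialCircuit M (χ I₁ ∩neg χ I₂) e))
lemma4p11 M _ TU _ _ I₁ I₂ S₁ _ = mk⇔ common-point⇒conditions conditions⇒common-point
  where
  common-point⇒conditions : ∃[ x ] (InRelInt M I₁ x × InRelInt M I₂ x) →
    (∀ e → EdgesOf (χ I₁) e ⇔ EdgesOf (χ I₂) e) × (∀ e → OneWay (χ I₁ ∩neg χ I₂) e → InPotentialCircuit M (χ I₁ ∩neg χ I₂) e)
  common-point⇒conditions (x , (c₁ , c₁>0 , c₁≡0 , _ , c₁↦x) , (c₂ , c₂>0 , c₂≡0 , _ , c₂↦x)) =
    same-edges , λ e one-way → conformal⇒potentialCircuit M TU F e w Mw≡0 (oneWay⇒w≢0 e one-way) w-conformal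
    where open Forward M I₁ I₂ x c₁ c₁>0 c₁≡0 c₁↦x c₂ c₂>0 c₂≡0 c₂↦x
  conditions⇒common-point : (∀ e → EdgesOf (χ I₁) e ⇔ EdgesOf (χ I₂) e) ×
    (∀ e → OneWay (χ I₁ ∩neg χ I₂) e → InPotentialCircuit M (χ I₁ ∩neg χ I₂) e) → ∃[ x ] (InRelInt M I₁ x × InRelInt M I₂ x)
  conditions⇒common-point (same-edges , circuits) = x , relint₁ , relint₂
    where open Backward M I₁ I₂ (proj₁ S₁) same-edges circuits
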